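{- Let $(H, \xi)$ be any infinitorial Hopf algebra. (i) There is a unique graded coalgebra map $\Psi \colon H \to \mathrm{Sh}$ satisfying $\xi = \xi_S \circ \Psi$. (ii) The map $\Psi$ is also an algebra map; hence, it is a map of infinitorial Hopf algebras $(H, \xi) \to (\mathrm{Sh}, \xi_S)$ and is the unique such map. (iii) The map $\Psi$ is given as follows: for $h \in H_n$, we have \[ \Psi(h) = \sum_{\alpha \vDash n} \left( \xi^{\otimes \ell(\alpha)} \Delta_\alpha(h) \right) x_\alpha. \]
   Context: All Hopf algebras are over a fixed field $\mathbbm{k}$, connected graded of finite type. For a composition $\alpha=(\alpha_1,\dots,\alpha_\ell)\vDash n$ (a sequence of positive integers summing to $n$, with length $\ell(\alpha)=\ell$) and $h\in H$, $\Delta_\alpha(h)$ is the projection of the iterated coproduct $\Delta^{\ell-1}(h)\in H^{\otimes \ell}$ onto $H_{\alpha_1}\otimes\dots\otimes H_{\alpha_\ell}$. An infinitesimal character of $H$ is a linear map $\xi\colon H\to\mathbbm{k}$ with $\xi(ab)=\varepsilon(a)\xi(b)+\xi(a)\varepsilon(b)$. An infinitorial Hopf algebra is a pair $(H,\xi)$ with $H$ connected graded and $\xi$ an infinitesimal character of $H$; a morphism $(H,\xi)\to(H',\xi')$ is a graded Hopf map $\Phi$ with $\xi=\xi'\circ\Phi$. For compositions $\alpha,\beta$, the shuffle set $\alpha \sqcup\!\sqcup \beta$ is the multiset of all compositions of length $\ell(\alpha)+\ell(\beta)$ containing $\alpha$ and $\beta$ as disjoint subsequences, taken with multiplicity. The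 shuffle algebra $\mathrm{Sh}$ is the connected graded Hopf algebra with basis $\{x_\alpha\}$ indexed by compositions, $\mathrm{Sh}_n=\operatorname{span}\{x_\alpha:\alpha\vDash n\}$, product $x_\alpha x_\beta=\sum_{\gamma\in\alpha \sqcup\!\sqcup \beta}x_\gamma$ and coproduct $\Delta(x_\gamma)=\sum_{\alpha\beta=\gamma}x_\alpha\otimes x_\beta$ (deconcatenation). The map $\xi_S\colon\mathrm{Sh}\to\mathbbm{k}$ is defined by $\xi_S(x_\alpha)=1$ if $\ell(\alpha)=1$ and $0$ otherwise; it is an infinitesimal character. -}

module Defs where

open import Level using (Level; _⊔_) renaming (suc to lsuc)
open import Algebra.Bundles using (CommutativeRing)
open import Data.Nat using (ℕ; zero; suc; _+_; _∸_; _≟_)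
open import Data.Fin using (Fin; zero; suc; toℕ)
open import Data.List using (List; []; _∷_; _++_; map; length; lookup; concatMap)
open import Data.List.Properties using (≡-dec)
open import Data.Product using (Σ; ∃; _×_; _,_)
open import Relation.Nullary using (¬_; yes; no)
open import Relation.Binary.PropositionalEquality using (_≡_; refl)

record Field (c ℓ : Level) : Set (lsuc (c ⊔ ℓ)) where
  field
    commutativeRing : CommutativeRing c ℓ
  open CommutativeRing commutativeRing public
  field
    0≉1     : ¬ (0# ≈ 1#)
    inverse : ∀ x → ¬ (x ≈ 0#) → ∃ λ y → x * y ≈ 1#

-- all compositions of n (each exactly once):
-- a composition of n+1 arises from one of n by prepending a new part 1
-- or by increasing its first part by 1
comps : ℕ → List (List ℕ)
comps zero    = [] ∷ []
comps (suc m) = concatMap ext (comps m)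
  where
  ext : List ℕ → List (List ℕ)
  ext []      = (1 ∷ []) ∷ []
  ext (a ∷ α) = (1 ∷ a ∷ α) ∷ (suc a ∷ α) ∷ []

-- the shuffle multiset  α ⧢ β , as a list with multiplicity
shuffle : List ℕ → List ℕ → List (List ℕ)
shuffle []       ys       = ys ∷ []
shuffle (x ∷ xs) []       = (x ∷ xs) ∷ []
shuffle (x ∷ xs) (y ∷ ys) = map (x ∷_) (shuffle xs (y ∷ ys)) ++ map (y ∷_) (shuffle (x ∷ xs) ys)

count : List ℕ → List (List ℕ) → ℕ
count α []      = 0
count α (γ ∷ L) with ≡-dec _≟_ α γ
... | yes _ = suc (count α L)
... | no  _ = count α L

module Over {c ℓ : Level} (F : Field c ℓ) where
  open Field F using (Carrier; _≈_; 0#; 1#) renaming (_+_ to _+ᴷ_; _*_ to _*ᴷ_)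

  K : Set c
  K = Carrier

  sumFin : (n : ℕ) → (Fin n → K) → K
  sumFin zero    f = 0#
  sumFin (suc n) f = f zero +ᴷ sumFin n (λ i → f (suc i))

  sumℕ : ℕ → (ℕ → K) → K
  sumℕ zero    f = 0#
  sumℕ (suc n) f = f 0 +ᴷ sumℕ n (λ k → f (suc k))

  natK : ℕ → K
  natK zero    = 0#
  natK (suc n) = 1# +ᴷ natK n

  -- A connected graded algebra/coalgebra of finite type, given by a
  -- homogeneous basis (basis of H_n indexed by Fin (dim n)) and
  -- structure constants.
  record GradedData : Set c where
    field
      dim : ℕ → ℕ
      -- e_i e_j = Σ_k μ p q i j k e_k      (e_i ∈ H_p, e_j ∈ H_q, e_k ∈ H_{p+q})
      μ   : ∀ p q → Fin (dim p) → Fin (dim q) → Fin (dim (p + q)) → K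
      -- Δ_{(p,q)}(e_k) = Σ_{i,j} δ p q k i j e_i ⊗ e_j
      δ   : ∀ p q → Fin (dim (p + q)) → Fin (dim p) → Fin (dim q) → K
      -- unit 1 = Σ_i η i e_i ∈ H_0
      η   : Fin (dim 0) → K
      -- counit on H_0 : ε(e_i) = ε i   (ε vanishes on H_n, n > 0)
      ε   : Fin (dim 0) → K

  module Ops (H : GradedData) where
    open GradedData H

    -- homogeneous elements of degree n (coordinates in the basis)
    V : ℕ → Set c
    V n = Fin (dim n) → K

    -- elements of H_p ⊗ H_q and H_p ⊗ H_q ⊗ H_r
    T : ℕ → ℕ → Set c
    T p q = Fin (dim p) → Fin (dim q) → K

    infix 4 _≈v_
    _≈v_ : ∀ {n} → V n → V n → Set ℓ
    a ≈v b = ∀ i → a i ≈ b i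

    zeroV : ∀ {n} → V n
    zeroV _ = 0#

    basis : ∀ {n} → Fin (dim n) → V n
    basis i j with Data.Fin._≟_ i j
    ... | yes _ = 1#
    ... | no  _ = 0#

    _•_ : ∀ {n} → K → V n → V n
    (x • a) i = x *ᴷ a i

    sumV : ∀ {n} (m : ℕ) → (Fin m → V n) → V n
    sumV m f i = sumFin m (λ k → f k i)

    sumVℕ : ∀ {n} (m : ℕ) → (ℕ → V n) → V n
    sumVℕ m f i = sumℕ m (λ k → f k i)

    -- inclusion of H_m in H; projection onto H_n : identity if m = n, zero otherwise
    cast : ∀ m n → V m → V n
    cast m n a with m ≟ n
    ... | yes refl = a
    ... | no  _    = zeroV

    castT : ∀ p q p′ q′ → T p q → T p′ q′
    castT p q p′ q′ X with p ≟ p′ | q ≟ q′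
    ... | yes refl | yes refl = X
    ... | _        | _        = λ _ _ → 0#

    mul : ∀ {p q} → V p → V q → V (p + q)
    mul {p} {q} a b k = sumFin (dim p) λ i → sumFin (dim q) λ j → a i *ᴷ b j *ᴷ μ p q i j k

    cop : ∀ p q → V (p + q) → T p q
    cop p q a i j = sumFin (dim (p + q)) λ k → a k *ᴷ δ p q k i j

    -- product on H ⊗ H : (x ⊗ y)(x′ ⊗ y′) = x x′ ⊗ y y′
    mulT : ∀ {a b a′ b′} → T a b → T a′ b′ → T (a + a′) (b + b′)
    mulT {a} {b} {a′} {b′} X Y i j =
      sumFin (dim a) λ u → sumFin (dim b) λ v → sumFin (dim a′) λ u′ → sumFin (dim b′) λ v′ →
        X u v *ᴷ Y u′ v′ *ᴷ μ a a′ u u′ i *ᴷ μ b b′ v v′ j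

    epsV : V 0 → K
    epsV a = sumFin (dim 0) λ i → a i *ᴷ ε i

    epsN : ∀ n → V n → K
    epsN n a = epsV (cast n 0 a)

    unitCounit : ∀ n → V n → V n
    unitCounit n a = cast 0 n (epsN n a • η)

    -- linear functionals H → K, given on the basis of each H_n
    Functional : Set c
    Functional = (n : ℕ) → Fin (dim n) → K

    applyF : Functional → ∀ n → V n → K
    applyF f n a = sumFin (dim n) λ i → a i *ᴷ f n i

  record IsConnectedHopf (H : GradedData) : Set (c ⊔ ℓ) where
    open GradedData H
    open Ops H
    field
      connected : dim 0 ≡ 1
      assoc     : ∀ p q r (a : V p) (b : V q) (e : V r) →
                  cast ((p + q) + r) (p + (q + r)) (mul (mul a b) e) ≈v mul a (mul b e)
      unitˡ     : ∀ p (a : V p) → mul η a ≈v a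
      unitʳ     : ∀ p (a : V p) → cast (p + 0) p (mul a η) ≈v a
      coassoc   : ∀ p q r (a : V ((p + q) + r)) i j k →
                  cop p q (λ l → cop (p + q) r a l k) i j
                    ≈ cop q r (λ m → cop p (q + r) (cast ((p + q) + r) (p + (q + r)) a) i m) j k
      counitˡ   : ∀ p (a : V p) j → epsV (λ i → cop 0 p a i j) ≈ a j
      counitʳ   : ∀ p (a : V p) i → epsV (λ j → cop p 0 (cast p (p + 0) a) i j) ≈ a i
      -- Δ(ab) = Δ(a) Δ(b), componentwise
      Δ-mul     : ∀ r s p q (a : V r) (b : V s) i j →
                  cop p q (cast (r + s) (p + q) (mul a b)) i j
                    ≈ (sumℕ (suc p) λ p₁ → sumℕ (suc q) λ q₁ →
                         castT (p₁ + (p ∸ p₁)) (q₁ + (q ∸ q₁)) p q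
                           (mulT (cop p₁ q₁ (cast r (p₁ + q₁) a))
                                 (cop (p ∸ p₁) (q ∸ q₁) (cast s ((p ∸ p₁) + (q ∸ q₁)) b))) i j)
      Δ-unit    : ∀ i j → cop 0 0 η i j ≈ η i *ᴷ η j
      ε-mul     : ∀ (a b : V 0) → epsV (mul a b) ≈ epsV a *ᴷ epsV b
      ε-unit    : epsV η ≈ 1#
      -- antipode S (graded linear map, given on the basis)
      antipode  : Σ ((n : ℕ) → Fin (dim n) → V n) λ S →
                    (∀ n (a : V n) →
                      sumVℕ (suc n) (λ p → cast (p + (n ∸ p)) n
                        (sumV (dim p) λ u → sumV (dim (n ∸ p)) λ v →
                           cop p (n ∸ p) (cast n (p + (n ∸ p)) a) u v • mul (S p u) (basis v)))
                      ≈v unitCounit n a)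
                  × (∀ n (a : V n) →
                      sumVℕ (suc n) (λ p → cast (p + (n ∸ p)) n
                        (sumV (dim p) λ u → sumV (dim (n ∸ p)) λ v →
                           cop p (n ∸ p) (cast n (p + (n ∸ p)) a) u v • mul (basis u) (S (n ∸ p) v)))
                      ≈v unitCounit n a)
    -- (sumVℕ (suc n) over p ranges over p = 0..n)

  -- infinitesimal character: ξ(ab) = ε(a)ξ(b) + ξ(a)ε(b)
  IsInfChar : (H : GradedData) → Ops.Functional H → Set ℓ
  IsInfChar H ξ = ∀ p q i j →
    applyF ξ (p + q) (μ p q i j) ≈ epsN p (basis i) *ᴷ ξ q j +ᴷ ξ p i *ᴷ epsN q (basis j)
    where open GradedData H
          open Ops H

  -- graded linear maps H → H′, given by the images of basis vectors
  GradedMap : GradedData → GradedData → Set c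
  GradedMap H H′ = (n : ℕ) → Fin (GradedData.dim H n) → Ops.V H′ n

  module _ (H H′ : GradedData) where
    private
      module H  = GradedData H
      module H′ = GradedData H′
      module O  = Ops H
      module O′ = Ops H′

    linMap : GradedMap H H′ → ∀ n → O.V n → O′.V n
    linMap f n a k = sumFin (H.dim n) λ i → a i *ᴷ f n i k

    _≈map_ : GradedMap H H′ → GradedMap H H′ → Set ℓ
    f ≈map g = ∀ n i k → f n i k ≈ g n i k

    _≈F_∘_ : O.Functional → O′.Functional → GradedMap H H′ → Set ℓ
    ξ ≈F ξ′ ∘ f = ∀ n i → ξ n i ≈ O′.applyF ξ′ n (f n i)

    record IsCoalgebraMap (f : GradedMap H H′) : Set (c ⊔ ℓ) where
      field
        cop-hom : ∀ p q k u v →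
                  O′.cop p q (f (p + q) k) u v
                    ≈ (sumFin (H.dim p) λ x → sumFin (H.dim q) λ y → H.δ p q k x y *ᴷ f p x u *ᴷ f q y v)
        ε-hom   : ∀ i → O′.epsV (f 0 i) ≈ H.ε i

    record IsAlgebraMap (f : GradedMap H H′) : Set (c ⊔ ℓ) where
      field
        mul-hom  : ∀ p q i j → linMap f (p + q) (H.μ p q i j) O′.≈v O′.mul (f p i) (f q j)
        unit-hom : linMap f 0 H.η O′.≈v H′.η

    -- graded Hopf maps (= bialgebra maps; antipodes are then automatically preserved)
    IsHopfMap : GradedMap H H′ → Set (c ⊔ ℓ)
    IsHopfMap f = IsCoalgebraMap f × IsAlgebraMap f

  -- The shuffle Hopf algebra Sh; the basis of Sh_n is {x_α : α ⊨ n},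
  -- x_α being the (index of α in comps n)-th basis vector
  compAt : (n : ℕ) → Fin (length (comps n)) → List ℕ
  compAt n = lookup (comps n)

  Sh : GradedData
  Sh = record
    { dim = λ n → length (comps n)
    ; μ   = λ p q i j k → natK (count (compAt (p + q) k) (shuffle (compAt p i) (compAt q j)))
    ; δ   = λ p q k i j → decK (compAt (p + q) k) (compAt p i ++ compAt q j)
    ; η   = λ _ → 1#
    ; ε   = λ _ → 1#
    }
    where
    decK : List ℕ → List ℕ → K
    decK α β with ≡-dec _≟_ α β
    ... | yes _ = 1#
    ... | no  _ = 0#

  ξS : Ops.Functional Sh
  ξS n i with length (compAt n i) ≟ 1
  ... | yes _ = 1#
  ... | no  _ = 0#

  -- ξ^{⊗ ℓ(α)} Δ_α (h)  for h ∈ H_n, computed via Δ_{(a,b,…)} = (id ⊗ Δ_{(b,…)}) Δ_{(a, n-a)}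
  module _ (H : GradedData) (ξ : Ops.Functional H) where
    open GradedData H
    open Ops H

    xiΔ : List ℕ → (n : ℕ) → V n → K
    xiΔ []          n h = epsN n h
    xiΔ (a ∷ [])    n h = applyF ξ a (cast n a h)
    xiΔ (a ∷ b ∷ β) n h =
      sumFin (dim a) λ i → ξ a i *ᴷ xiΔ (b ∷ β) (n ∸ a) (λ j → cop a (n ∸ a) (cast n (a + (n ∸ a)) h) i j)

-- By coassociativity Δ_{α++β} factors through
-- Δ_{(|α|,|β|)}, which says exactly that Ψ intertwines Δ with deconcatenation.  Conversely, the x_α-coefficient
-- of a coalgebra map into Sh is determined, through the deconcatenation component at ((a), α′) for α = a ∷ α′,
-- by coefficients at one-part compositions, which are fixed by ξ = ξ_S ∘ Ψ; this gives uniqueness.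
-- Multiplicativity is the identity ξ^{⊗ℓ(γ)} Δ_γ(ab) = Σ_{α,β} ξ^{⊗ℓ(α)}Δ_α(a) ξ^{⊗ℓ(β)}Δ_β(b) [γ : α ⧢ β],
-- proved by induction on γ: in Δ(ab) = Δ(a)Δ(b) the infinitesimal character ξ kills every term in which the
-- first part of γ takes positive degree from both a and b, and the two surviving terms match the recursion
-- of the shuffle count according to whether the first letter of γ comes from α or from β.

module Submission where

open import Defs
open import Level using (Level)
open import Data.Bool using (true; false; if_then_else_)
open import Data.Product using (Σ; _×_; _,_; proj₁; proj₂)
open import Data.Nat using (ℕ; zero; suc; _+_; _∸_; _≟_; _≤_; _<_; _≤?_; z≤n; s≤s; _≡ᵇ_)
import Data.Nat.Properties as ℕ
open import Data.Nat.ListAction using (sum)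
open import Data.Fin using (Fin; zero; suc)
import Data.Fin.Properties as Fin
open import Data.List using (List; []; _∷_; _++_; map; concatMap; length; lookup)
open import Data.List.Properties using (≡-dec; ∷-injectiveˡ; ∷-injectiveʳ)
open import Data.List.Relation.Unary.All as All using (All; []; _∷_)
open import Data.List.Relation.Unary.All.Properties using (++⁺)
open import Data.List.Membership.Propositional.Properties using (∈-lookup)
open import Data.Empty using (⊥-elim)
open import Relation.Binary.PropositionalEquality as ≡ using (_≡_; _≢_; refl; cong; cong₂; sym; trans; subst)
open import Relation.Nullary using (yes; no)
import Algebra.Solver.Ring.NaturalCoefficients.Default as NaturalSolver

-- Compositions and shuffle counts

infix 4 _⊨_
data _⊨_ : List ℕ → ℕ → Set where
  []  : [] ⊨ 0
  _∷_ : ∀ a {α n} → α ⊨ n → (suc a ∷ α) ⊨ suc a + n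

⊨-++ : ∀ {α β p q} → α ⊨ p → β ⊨ q → (α ++ β) ⊨ p + q
⊨-++ []                  β⊨q = β⊨q
⊨-++ {β = β} {q = q} (_∷_ a {α} {n} α⊨n) β⊨q =
  subst (λ k → (suc a ∷ α ++ β) ⊨ k) (sym (ℕ.+-assoc (suc a) n q)) (a ∷ ⊨-++ α⊨n β⊨q)

⊨-singleton : ∀ n → (suc n ∷ []) ⊨ suc n
⊨-singleton n = subst (λ k → (suc n ∷ []) ⊨ suc k) (ℕ.+-identityʳ n) (n ∷ [])

singleton-⊨ : ∀ {n γ} → γ ⊨ n → length γ ≡ 1 → γ ≡ n ∷ []
singleton-⊨ (a ∷ [])      _ = cong (_∷ []) (sym (ℕ.+-identityʳ (suc a)))
singleton-⊨ (a ∷ (b ∷ _)) ()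

-- Defs.comps is defined through a local step function, which we recover from its defining equation.
comps-step : Σ (ℕ → List ℕ → List (List ℕ)) λ step → ∀ m → comps (suc m) ≡ concatMap (step m) (comps m)
comps-step = _ , λ m → refl

step : ℕ → List ℕ → List (List ℕ)
step = proj₁ comps-step

comps-sound : ∀ n → All (_⊨ n) (comps n)
comps-sound zero    = [] ∷ []
comps-sound (suc n) = concatMap⁺ (comps-sound n)
  where
  step-sound : ∀ {α} → α ⊨ n → All (_⊨ suc n) (step n α)
  step-sound []      = (0 ∷ []) ∷ []
  step-sound (a ∷ α) = (0 ∷ a ∷ α) ∷ (suc a ∷ α) ∷ []
  concatMap⁺ : ∀ {L} → All (_⊨ n) L → All (_⊨ suc n) (concatMap (step n) L)
  concatMap⁺ []         = []
  concatMap⁺ (α ∷ αs) = ++⁺ (step-sound α) (concatMap⁺ αs)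

count-here : ∀ {x y} L → x ≡ y → count x (y ∷ L) ≡ suc (count x L)
count-here {x} {y} L x≡y with ≡-dec _≟_ x y
... | yes _   = refl
... | no  x≢y = ⊥-elim (x≢y x≡y)

count-there : ∀ {x y} L → x ≢ y → count x (y ∷ L) ≡ count x L
count-there {x} {y} L x≢y with ≡-dec _≟_ x y
... | yes x≡y = ⊥-elim (x≢y x≡y)
... | no  _   = refl

count-++ : ∀ x L M → count x (L ++ M) ≡ count x L + count x M
count-++ x []      M = refl
count-++ x (y ∷ L) M with ≡-dec _≟_ x y
... | yes _ = cong suc (count-++ x L M)
... | no  _ = count-++ x L M

count-singleton-injective : ∀ (f : List ℕ → List ℕ) → (∀ {u v} → f u ≡ f v → u ≡ v) →
                            ∀ x y → count (f x) (f y ∷ []) ≡ count x (y ∷ [])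
count-singleton-injective f f-inj x y with ≡-dec _≟_ x y
... | yes refl = count-here {f x} [] refl
... | no  x≢y  = count-there {f x} [] (λ e → x≢y (f-inj e))

count-concatMap : ∀ x (f : List ℕ → List (List ℕ)) L →
                  count x (concatMap f L) ≡ sum (map (λ α → count x (f α)) L)
count-concatMap x f []      = refl
count-concatMap x f (α ∷ L) = trans (count-++ x (f α) (concatMap f L)) (cong (count x (f α) +_) (count-concatMap x f L))

sum-map-cong-All : ∀ {P : List ℕ → Set} {L} → All P L → {f g : List ℕ → ℕ} → (∀ x → P x → f x ≡ g x) →
                   sum (map f L) ≡ sum (map g L)
sum-map-cong-All []       e = refl
sum-map-cong-All (p ∷ ps) e = cong₂ _+_ (e _ p) (sum-map-cong-All ps e)

sum-count-singleton : ∀ x L → sum (map (λ α → count x (α ∷ [])) L) ≡ count x L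
sum-count-singleton x []      = refl
sum-count-singleton x (y ∷ L) with ≡-dec _≟_ x y
... | yes _ = cong suc (sum-count-singleton x L)
... | no  _ = sum-count-singleton x L

incrHead : List ℕ → List ℕ
incrHead []      = []
incrHead (b ∷ β) = suc b ∷ β

incrHead-injective : ∀ {u v} → incrHead u ≡ incrHead v → u ≡ v
incrHead-injective {[]}    {[]}    _ = refl
incrHead-injective {_ ∷ _} {_ ∷ _} e = cong₂ _∷_ (ℕ.suc-injective (∷-injectiveˡ e)) (∷-injectiveʳ e)

-- suc a ∷ γ with its first part lowered by one
lowerHead : ℕ → List ℕ → List ℕ
lowerHead zero    γ = γ
lowerHead (suc a) γ = suc a ∷ γ

count-step : ∀ {m α} → α ⊨ m → ∀ a γ → count (suc a ∷ γ) (step m α) ≡ count (lowerHead a γ) (α ∷ [])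
count-step []      zero    γ = count-singleton-injective (1 ∷_) ∷-injectiveʳ γ []
count-step (_∷_ x {α} _) zero γ = begin
  count (1 ∷ γ) (((1 ∷ suc x ∷ α) ∷ []) ++ ((suc (suc x) ∷ α) ∷ []))
    ≡⟨ count-++ (1 ∷ γ) ((1 ∷ suc x ∷ α) ∷ []) ((suc (suc x) ∷ α) ∷ []) ⟩
  count (1 ∷ γ) ((1 ∷ suc x ∷ α) ∷ []) + count (1 ∷ γ) ((suc (suc x) ∷ α) ∷ [])
    ≡⟨ cong₂ _+_ (count-singleton-injective (1 ∷_) ∷-injectiveʳ γ (suc x ∷ α))
                 (count-there {1 ∷ γ} {suc (suc x) ∷ α} [] (λ ())) ⟩
  count γ ((suc x ∷ α) ∷ []) + 0
    ≡⟨ ℕ.+-identityʳ _ ⟩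
  count γ ((suc x ∷ α) ∷ []) ∎
  where open ≡.≡-Reasoning
count-step []      (suc a) γ =
  trans (count-there {suc (suc a) ∷ γ} {1 ∷ []} [] (λ ())) (sym (count-there {suc a ∷ γ} {[]} [] (λ ())))
count-step (_∷_ x {α} _) (suc a) γ =
  trans (count-++ (suc (suc a) ∷ γ) ((1 ∷ suc x ∷ α) ∷ []) ((suc (suc x) ∷ α) ∷ []))
        (cong₂ _+_ (count-there {suc (suc a) ∷ γ} {1 ∷ suc x ∷ α} [] (λ ()))
                   (count-singleton-injective incrHead incrHead-injective (suc a ∷ γ) (suc x ∷ α)))

count-comps-suc : ∀ m a γ → count (suc a ∷ γ) (comps (suc m)) ≡ count (lowerHead a γ) (comps m)
count-comps-suc m a γ = begin
  count (suc a ∷ γ) (concatMap (step m) (comps m))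
    ≡⟨ count-concatMap (suc a ∷ γ) (step m) (comps m) ⟩
  sum (map (λ α → count (suc a ∷ γ) (step m α)) (comps m))
    ≡⟨ sum-map-cong-All (comps-sound m) (λ α α⊨m → count-step α⊨m a γ) ⟩
  sum (map (λ α → count (lowerHead a γ) (α ∷ [])) (comps m))
    ≡⟨ sum-count-singleton (lowerHead a γ) (comps m) ⟩
  count (lowerHead a γ) (comps m) ∎
  where open ≡.≡-Reasoning

count-∷-comps : ∀ a {n γ} → count γ (comps n) ≡ 1 → count (suc a ∷ γ) (comps (suc a + n)) ≡ 1
count-∷-comps zero    {n} {γ} count≡1 = trans (count-comps-suc n 0 γ) count≡1
count-∷-comps (suc a) {n} {γ} count≡1 = trans (count-comps-suc (suc a + n) (suc a) γ) (count-∷-comps a count≡1)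

count-comps : ∀ {n γ} → γ ⊨ n → count γ (comps n) ≡ 1
count-comps []        = refl
count-comps (a ∷ γ⊨n) = count-∷-comps a (count-comps γ⊨n)

lookup-index : ∀ x L → count x L ≢ 0 → Σ (Fin (length L)) λ k → lookup L k ≡ x
lookup-index x []      count≢0 = ⊥-elim (count≢0 refl)
lookup-index x (y ∷ L) count≢0 with ≡-dec _≟_ x y
... | yes x≡y = zero , sym x≡y
... | no  _ with lookup-index x L count≢0
...   | k , lookup≡x = suc k , lookup≡x

lookup≡⇒count≢0 : ∀ x L (k : Fin (length L)) → lookup L k ≡ x → count x L ≢ 0
lookup≡⇒count≢0 x (y ∷ L) k lookup≡x with ≡-dec _≟_ x y
... | yes _ = λ ()
lookup≡⇒count≢0 x (y ∷ L) zero    lookup≡x | no x≢y = ⊥-elim (x≢y (sym lookup≡x))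
lookup≡⇒count≢0 x (y ∷ L) (suc k) lookup≡x | no _   = lookup≡⇒count≢0 x L k lookup≡x

lookup-unique : ∀ x L → count x L ≡ 1 → (k k′ : Fin (length L)) → lookup L k ≡ x → lookup L k′ ≡ x → k ≡ k′
lookup-unique x (y ∷ L) count≡1 zero    zero    _ _ = refl
lookup-unique x (y ∷ L) count≡1 zero    (suc k′) e e′ with ≡-dec _≟_ x y
... | yes _   = ⊥-elim (lookup≡⇒count≢0 x L k′ e′ (ℕ.suc-injective count≡1))
... | no  x≢y = ⊥-elim (x≢y (sym e))
lookup-unique x (y ∷ L) count≡1 (suc k) zero    e e′ with ≡-dec _≟_ x y
... | yes _   = ⊥-elim (lookup≡⇒count≢0 x L k e (ℕ.suc-injective count≡1))
... | no  x≢y = ⊥-elim (x≢y (sym e′))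
lookup-unique x (y ∷ L) count≡1 (suc k) (suc k′) e e′ with ≡-dec _≟_ x y
... | yes _ = ⊥-elim (lookup≡⇒count≢0 x L k e (ℕ.suc-injective count≡1))
... | no  _ = cong suc (lookup-unique x L count≡1 k k′ e e′)

indexOf : ∀ {n γ} → γ ⊨ n → Σ (Fin (length (comps n))) λ k → lookup (comps n) k ≡ γ
indexOf {n} {γ} γ⊨n = lookup-index γ (comps n) λ count≡0 → ℕ.0≢1+n (trans (sym count≡0) (count-comps γ⊨n))

index-unique : ∀ {n γ} → γ ⊨ n → (k k′ : Fin (length (comps n))) →
               lookup (comps n) k ≡ γ → lookup (comps n) k′ ≡ γ → k ≡ k′
index-unique {n} {γ} γ⊨n = lookup-unique γ (comps n) (count-comps γ⊨n)

onHead : ∀ {a} {A : Set a} → A → ℕ → List ℕ → (List ℕ → A) → A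
onHead z c []      G = z
onHead z c (x ∷ β) G = if c ≡ᵇ x then G β else z

count-∷-singleton : ∀ c γ x β → count (c ∷ γ) ((x ∷ β) ∷ []) ≡ (if c ≡ᵇ x then count γ (β ∷ []) else 0)
count-∷-singleton zero    γ zero    β = count-singleton-injective (0 ∷_) ∷-injectiveʳ γ β
count-∷-singleton zero    γ (suc x) β = count-there {0 ∷ γ} {suc x ∷ β} [] (λ ())
count-∷-singleton (suc c) γ zero    β = count-there {suc c ∷ γ} {0 ∷ β} [] (λ ())
count-∷-singleton (suc c) γ (suc x) β =
  trans (count-singleton-injective incrHead incrHead-injective (c ∷ γ) (x ∷ β)) (count-∷-singleton c γ x β)

count-∷-map : ∀ c γ x S → count (c ∷ γ) (map (x ∷_) S) ≡ (if c ≡ᵇ x then count γ S else 0)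
count-∷-map c γ x [] with c ≡ᵇ x
... | true  = refl
... | false = refl
count-∷-map c γ x (β ∷ S) =
  trans (count-++ (c ∷ γ) ((x ∷ β) ∷ []) (map (x ∷_) S))
        (trans (cong₂ _+_ (count-∷-singleton c γ x β) (count-∷-map c γ x S))
               (sym (trans (cong (λ k → if c ≡ᵇ x then k else 0) (count-++ γ (β ∷ []) S)) (if-distrib-+ (c ≡ᵇ x)))))
  where
  if-distrib-+ : ∀ b {u v} → (if b then u + v else 0) ≡ (if b then u else 0) + (if b then v else 0)
  if-distrib-+ true  = refl
  if-distrib-+ false = refl

shuffle-[]ʳ : ∀ α → shuffle α [] ≡ α ∷ []
shuffle-[]ʳ []      = refl
shuffle-[]ʳ (x ∷ α) = refl

count-shuffle-∷ : ∀ c γ α β → count (c ∷ γ) (shuffle α β)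
                  ≡ onHead 0 c α (λ α′ → count γ (shuffle α′ β)) + onHead 0 c β (λ β′ → count γ (shuffle α β′))
count-shuffle-∷ c γ []      []      = count-there {c ∷ γ} {[]} [] (λ ())
count-shuffle-∷ c γ []      (y ∷ β) = count-∷-singleton c γ y β
count-shuffle-∷ c γ (x ∷ α) []      = begin
  count (c ∷ γ) ((x ∷ α) ∷ [])
    ≡⟨ count-∷-singleton c γ x α ⟩
  (if c ≡ᵇ x then count γ (α ∷ []) else 0)
    ≡⟨ cong (λ L → if c ≡ᵇ x then count γ L else 0) (sym (shuffle-[]ʳ α)) ⟩
  (if c ≡ᵇ x then count γ (shuffle α []) else 0)
    ≡⟨ sym (ℕ.+-identityʳ _) ⟩
  (if c ≡ᵇ x then count γ (shuffle α []) else 0) + 0 ∎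
  where open ≡.≡-Reasoning
count-shuffle-∷ c γ (x ∷ α) (y ∷ β) =
  trans (count-++ (c ∷ γ) (map (x ∷_) (shuffle α (y ∷ β))) (map (y ∷_) (shuffle (x ∷ α) β)))
        (cong₂ _+_ (count-∷-map c γ x (shuffle α (y ∷ β))) (count-∷-map c γ y (shuffle (x ∷ α) β)))

-- Finite sums over a field

module FiniteSums {c ℓ : Level} (F : Field c ℓ) where
  open Over F
  open Field F public
    using (Carrier; _≈_; 0#; 1#; setoid; -_; -‿inverseʳ
          ; +-cong; +-congˡ; +-congʳ; *-cong; *-congˡ; *-congʳ; +-assoc; +-comm; *-assoc; *-comm
          ; distribˡ; distribʳ; zeroˡ; zeroʳ; +-identityˡ; +-identityʳ; *-identityˡ; *-identityʳ)
    renaming (_+_ to _+ᴷ_; _*_ to _*ᴷ_; refl to ≈-refl; sym to ≈-sym; trans to ≈-trans)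
  open import Relation.Binary.Reasoning.Setoid setoid public
  open import Algebra.Properties.CommutativeSemigroup (Field.+-commutativeSemigroup F) public
    using () renaming (interchange to +-interchange)
  open import Algebra.Properties.CommutativeSemigroup (Field.*-commutativeSemigroup F) public
    using () renaming (x∙yz≈y∙xz to *-leftSwap)
  open NaturalSolver (Field.commutativeSemiring F) public using (solve; _:*_; _:=_)

  ≡⇒≈ : ∀ {x y} → x ≡ y → x ≈ y
  ≡⇒≈ refl = ≈-refl

  x+x≈x⇒x≈0 : ∀ x → x +ᴷ x ≈ x → x ≈ 0#
  x+x≈x⇒x≈0 x e = begin
    x                 ≈⟨ ≈-sym (+-identityʳ x) ⟩
    x +ᴷ 0#           ≈⟨ +-congˡ (≈-sym (-‿inverseʳ x)) ⟩
    x +ᴷ (x +ᴷ - x)   ≈⟨ ≈-sym (+-assoc x x _) ⟩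
    (x +ᴷ x) +ᴷ - x   ≈⟨ +-congʳ e ⟩
    x +ᴷ - x          ≈⟨ -‿inverseʳ x ⟩
    0#                ∎

  sumFin-cong : ∀ n {f g : Fin n → Carrier} → (∀ i → f i ≈ g i) → sumFin n f ≈ sumFin n g
  sumFin-cong zero    e = ≈-refl
  sumFin-cong (suc n) e = +-cong (e zero) (sumFin-cong n (λ i → e (suc i)))

  sumFin-distrib-+ : ∀ n (f g : Fin n → Carrier) → sumFin n (λ i → f i +ᴷ g i) ≈ sumFin n f +ᴷ sumFin n g
  sumFin-distrib-+ zero    f g = ≈-sym (+-identityˡ 0#)
  sumFin-distrib-+ (suc n) f g = ≈-trans (+-congˡ (sumFin-distrib-+ n _ _)) (+-interchange _ _ _ _)

  *-distribˡ-sumFin : ∀ n x (f : Fin n → Carrier) → x *ᴷ sumFin n f ≈ sumFin n (λ i → x *ᴷ f i)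
  *-distribˡ-sumFin zero    x f = zeroʳ x
  *-distribˡ-sumFin (suc n) x f = ≈-trans (distribˡ x _ _) (+-congˡ (*-distribˡ-sumFin n x _))

  *-distribʳ-sumFin : ∀ n x (f : Fin n → Carrier) → sumFin n f *ᴷ x ≈ sumFin n (λ i → f i *ᴷ x)
  *-distribʳ-sumFin zero    x f = zeroˡ x
  *-distribʳ-sumFin (suc n) x f = ≈-trans (distribʳ x _ _) (+-congˡ (*-distribʳ-sumFin n x _))

  sumFin-zero : ∀ n {f : Fin n → Carrier} → (∀ i → f i ≈ 0#) → sumFin n f ≈ 0#
  sumFin-zero zero    e = ≈-refl
  sumFin-zero (suc n) e = ≈-trans (+-cong (e zero) (sumFin-zero n (λ i → e (suc i)))) (+-identityˡ 0#)

  sumFin-comm : ∀ m n (f : Fin m → Fin n → Carrier) →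
    sumFin m (λ i → sumFin n (f i)) ≈ sumFin n (λ j → sumFin m (λ i → f i j))
  sumFin-comm zero    n f = ≈-sym (sumFin-zero n (λ _ → ≈-refl))
  sumFin-comm (suc m) n f =
    ≈-trans (+-congˡ (sumFin-comm m n (λ i → f (suc i)))) (≈-sym (sumFin-distrib-+ n _ _))

  sumFin-select : ∀ n (k : Fin n) (f : Fin n → Carrier) → (∀ j → k ≢ j → f j ≈ 0#) → sumFin n f ≈ f k
  sumFin-select (suc n) zero    f e =
    ≈-trans (+-congˡ (sumFin-zero n (λ j → e (suc j) (λ ())))) (+-identityʳ _)
  sumFin-select (suc n) (suc k) f e = ≈-trans (+-congʳ (e zero (λ ()))) (≈-trans (+-identityˡ _)
    (sumFin-select n k (λ j → f (suc j)) (λ j k≢j → e (suc j) (λ { refl → k≢j refl }))))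

  sumFin-matrix-assoc : ∀ m n (A : Fin m → Carrier) (B : Fin m → Fin n → Carrier) (w : Fin n → Carrier) →
    sumFin n (λ i → sumFin m (λ k → A k *ᴷ B k i) *ᴷ w i) ≈ sumFin m (λ k → A k *ᴷ sumFin n (λ i → B k i *ᴷ w i))
  sumFin-matrix-assoc m n A B w = begin
    sumFin n (λ i → sumFin m (λ k → A k *ᴷ B k i) *ᴷ w i)     ≈⟨ sumFin-cong n (λ i → *-distribʳ-sumFin m (w i) _) ⟩
    sumFin n (λ i → sumFin m (λ k → A k *ᴷ B k i *ᴷ w i))     ≈⟨ sumFin-comm n m _ ⟩
    sumFin m (λ k → sumFin n (λ i → A k *ᴷ B k i *ᴷ w i))     ≈⟨ sumFin-cong m (λ k → sumFin-cong n (λ i → *-assoc _ _ _)) ⟩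
    sumFin m (λ k → sumFin n (λ i → A k *ᴷ (B k i *ᴷ w i)))   ≈⟨ sumFin-cong m (λ k → ≈-sym (*-distribˡ-sumFin n (A k) _)) ⟩
    sumFin m (λ k → A k *ᴷ sumFin n (λ i → B k i *ᴷ w i))     ∎

  sumℕ-cong-< : ∀ n {f g : ℕ → Carrier} → (∀ i → i < n → f i ≈ g i) → sumℕ n f ≈ sumℕ n g
  sumℕ-cong-< zero    e = ≈-refl
  sumℕ-cong-< (suc n) e = +-cong (e zero (s≤s z≤n)) (sumℕ-cong-< n (λ i i<n → e (suc i) (s≤s i<n)))

  sumℕ-cong : ∀ n {f g : ℕ → Carrier} → (∀ i → f i ≈ g i) → sumℕ n f ≈ sumℕ n g
  sumℕ-cong n e = sumℕ-cong-< n (λ i _ → e i)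

  sumℕ-zero-< : ∀ n {f : ℕ → Carrier} → (∀ i → i < n → f i ≈ 0#) → sumℕ n f ≈ 0#
  sumℕ-zero-< zero    e = ≈-refl
  sumℕ-zero-< (suc n) e =
    ≈-trans (+-cong (e zero (s≤s z≤n)) (sumℕ-zero-< n (λ i i<n → e (suc i) (s≤s i<n)))) (+-identityˡ 0#)

  sumℕ-select : ∀ n k {f : ℕ → Carrier} → k < n → (∀ i → i < n → i ≢ k → f i ≈ 0#) → sumℕ n f ≈ f k
  sumℕ-select (suc n) zero    k<n e =
    ≈-trans (+-congˡ (sumℕ-zero-< n (λ i i<n → e (suc i) (s≤s i<n) (λ ())))) (+-identityʳ _)
  sumℕ-select (suc n) (suc k) (s≤s k<n) e = ≈-trans (+-congʳ (e zero (s≤s z≤n) (λ ()))) (≈-trans (+-identityˡ _)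
    (sumℕ-select n k k<n (λ i i<n i≢k → e (suc i) (s≤s i<n) (λ { refl → i≢k refl }))))

  *-distribʳ-sumℕ : ∀ n x (f : ℕ → Carrier) → sumℕ n f *ᴷ x ≈ sumℕ n (λ i → f i *ᴷ x)
  *-distribʳ-sumℕ zero    x f = zeroˡ x
  *-distribʳ-sumℕ (suc n) x f = ≈-trans (distribʳ x _ _) (+-congˡ (*-distribʳ-sumℕ n x _))

  sumℕ-sumFin-comm : ∀ m n (f : ℕ → Fin n → Carrier) →
    sumℕ m (λ i → sumFin n (f i)) ≈ sumFin n (λ j → sumℕ m (λ i → f i j))
  sumℕ-sumFin-comm zero    n f = ≈-sym (sumFin-zero n (λ _ → ≈-refl))
  sumℕ-sumFin-comm (suc m) n f =
    ≈-trans (+-congˡ (sumℕ-sumFin-comm m n (λ i → f (suc i)))) (≈-sym (sumFin-distrib-+ n _ _))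

module CompositionSums {c ℓ : Level} (F : Field c ℓ) where
  open Over F
  open FiniteSums F

  sumList : List (List ℕ) → (List ℕ → Carrier) → Carrier
  sumList []      f = 0#
  sumList (α ∷ L) f = f α +ᴷ sumList L f

  sumFin-lookup : ∀ L (f : List ℕ → Carrier) → sumFin (length L) (λ k → f (lookup L k)) ≈ sumList L f
  sumFin-lookup []      f = ≈-refl
  sumFin-lookup (α ∷ L) f = +-congˡ (sumFin-lookup L f)

  sumList-cong : ∀ L {f g : List ℕ → Carrier} → (∀ α → f α ≈ g α) → sumList L f ≈ sumList L g
  sumList-cong []      e = ≈-refl
  sumList-cong (α ∷ L) e = +-cong (e α) (sumList-cong L e)

  sumList-cong-All : ∀ {P : List ℕ → Set} {L} → All P L → {f g : List ℕ → Carrier} →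
                     (∀ α → P α → f α ≈ g α) → sumList L f ≈ sumList L g
  sumList-cong-All []       e = ≈-refl
  sumList-cong-All (p ∷ ps) e = +-cong (e _ p) (sumList-cong-All ps e)

  sumList-++ : ∀ L M (f : List ℕ → Carrier) → sumList (L ++ M) f ≈ sumList L f +ᴷ sumList M f
  sumList-++ []      M f = ≈-sym (+-identityˡ _)
  sumList-++ (α ∷ L) M f = ≈-trans (+-congˡ (sumList-++ L M f)) (≈-sym (+-assoc _ _ _))

  sumList-concatMap : ∀ (g : List ℕ → List (List ℕ)) L (f : List ℕ → Carrier) →
                      sumList (concatMap g L) f ≈ sumList L (λ α → sumList (g α) f)
  sumList-concatMap g []      f = ≈-refl
  sumList-concatMap g (α ∷ L) f = ≈-trans (sumList-++ (g α) (concatMap g L) f) (+-congˡ (sumList-concatMap g L f))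

  sumList-zero : ∀ L {f : List ℕ → Carrier} → (∀ α → f α ≈ 0#) → sumList L f ≈ 0#
  sumList-zero []      e = ≈-refl
  sumList-zero (α ∷ L) e = ≈-trans (+-cong (e α) (sumList-zero L e)) (+-identityˡ 0#)

  sumList-distrib-+ : ∀ L (f g : List ℕ → Carrier) → sumList L (λ α → f α +ᴷ g α) ≈ sumList L f +ᴷ sumList L g
  sumList-distrib-+ []      f g = ≈-sym (+-identityˡ 0#)
  sumList-distrib-+ (α ∷ L) f g = ≈-trans (+-congˡ (sumList-distrib-+ L f g)) (+-interchange _ _ _ _)

  *-distribˡ-sumList : ∀ L x (f : List ℕ → Carrier) → x *ᴷ sumList L f ≈ sumList L (λ α → x *ᴷ f α)
  *-distribˡ-sumList []      x f = zeroʳ x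
  *-distribˡ-sumList (α ∷ L) x f = ≈-trans (distribˡ x _ _) (+-congˡ (*-distribˡ-sumList L x f))

  sumList-comm : ∀ L M (f : List ℕ → List ℕ → Carrier) →
                 sumList L (λ α → sumList M (f α)) ≈ sumList M (λ β → sumList L (λ α → f α β))
  sumList-comm []      M f = ≈-sym (sumList-zero M (λ _ → ≈-refl))
  sumList-comm (α ∷ L) M f = ≈-trans (+-congˡ (sumList-comm L M f)) (≈-sym (sumList-distrib-+ M _ _))

  sumFin-sumList-comm : ∀ n L (f : Fin n → List ℕ → Carrier) →
                        sumFin n (λ i → sumList L (f i)) ≈ sumList L (λ α → sumFin n (λ i → f i α))
  sumFin-sumList-comm zero    L f = ≈-sym (sumList-zero L (λ _ → ≈-refl))
  sumFin-sumList-comm (suc n) L f =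
    ≈-trans (+-congˡ (sumFin-sumList-comm n L (λ i → f (suc i)))) (≈-sym (sumList-distrib-+ L _ _))

  natK-+ : ∀ m n → natK (m + n) ≈ natK m +ᴷ natK n
  natK-+ zero    n = ≈-sym (+-identityˡ _)
  natK-+ (suc m) n = ≈-trans (+-congˡ (natK-+ m n)) (≈-sym (+-assoc _ _ _))

  natK-onHead : ∀ c β (G : List ℕ → ℕ) → natK (onHead 0 c β G) ≈ onHead 0# c β (λ β′ → natK (G β′))
  natK-onHead c []      G = ≈-refl
  natK-onHead c (x ∷ β) G with c ≡ᵇ x
  ... | true  = ≈-refl
  ... | false = ≈-refl

  *-onHead : ∀ c β (k : List ℕ → Carrier) G → k β *ᴷ onHead 0# c β G ≈ onHead 0# c β (λ β′ → k (c ∷ β′) *ᴷ G β′)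
  *-onHead c       []            k G = zeroʳ _
  *-onHead zero    (zero  ∷ β)   k G = ≈-refl
  *-onHead zero    (suc x ∷ β)   k G = zeroʳ _
  *-onHead (suc c) (zero  ∷ β)   k G = zeroʳ _
  *-onHead (suc c) (suc x ∷ β)   k G = *-onHead c (x ∷ β) (λ { [] → k [] ; (y ∷ β′) → k (suc y ∷ β′) }) G

  private
    sumList-step-onHead-1 : ∀ m {n α} → α ⊨ n → (G : List ℕ → Carrier) →
                            sumList (step m α) (λ β → onHead 0# 1 β G) ≈ G α
    sumList-step-onHead-1 m []      G = +-identityʳ _
    sumList-step-onHead-1 m (a ∷ _) G = ≈-trans (+-congˡ (+-identityˡ _)) (+-identityʳ _)

    sumList-step-onHead-suc : ∀ m {n α} → α ⊨ n → ∀ c (G : List ℕ → Carrier) →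
                              sumList (step m α) (λ β → onHead 0# (suc (suc c)) β G) ≈ onHead 0# (suc c) α G
    sumList-step-onHead-suc m []      c G = +-identityˡ _
    sumList-step-onHead-suc m (a ∷ _) c G = ≈-trans (+-identityˡ _) (+-identityʳ _)

  sumList-onHead-comps : ∀ c m (G : List ℕ → Carrier) →
                         sumList (comps (suc c + m)) (λ β → onHead 0# (suc c) β G) ≈ sumList (comps m) G
  sumList-onHead-comps zero    m G = ≈-trans (sumList-concatMap (step m) (comps m) _)
    (sumList-cong-All (comps-sound m) (λ α α⊨m → sumList-step-onHead-1 m α⊨m G))
  sumList-onHead-comps (suc c) m G = ≈-trans (sumList-concatMap (step (suc c + m)) (comps (suc c + m)) _)
    (≈-trans (sumList-cong-All (comps-sound (suc c + m)) (λ α α⊨ → sumList-step-onHead-suc (suc c + m) α⊨ c G))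
             (sumList-onHead-comps c m G))

  sumList-onHead-comps-< : ∀ c q (G : List ℕ → Carrier) → q < suc c →
                           sumList (comps q) (λ β → onHead 0# (suc c) β G) ≈ 0#
  sumList-onHead-comps-< c       zero    G _ = +-identityʳ _
  sumList-onHead-comps-< (suc c) (suc q) G (s≤s q<1+c) = ≈-trans (sumList-concatMap (step q) (comps q) _)
    (≈-trans (sumList-cong-All (comps-sound q) (λ α α⊨q → sumList-step-onHead-suc q α⊨q c G))
             (sumList-onHead-comps-< c q G q<1+c))

  shuffleCoeff : List ℕ → List ℕ → List ℕ → Carrier
  shuffleCoeff γ α β = natK (count γ (shuffle α β))

  shuffleCoeff-∷ : ∀ c γ α β → shuffleCoeff (c ∷ γ) α β
                   ≈ onHead 0# c α (λ α′ → shuffleCoeff γ α′ β) +ᴷ onHead 0# c β (λ β′ → shuffleCoeff γ α β′)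
  shuffleCoeff-∷ c γ α β = begin
    natK (count (c ∷ γ) (shuffle α β))
      ≈⟨ ≡⇒≈ (cong natK (count-shuffle-∷ c γ α β)) ⟩
    natK (onHead 0 c α Gα + onHead 0 c β Gβ)
      ≈⟨ natK-+ (onHead 0 c α Gα) (onHead 0 c β Gβ) ⟩
    natK (onHead 0 c α Gα) +ᴷ natK (onHead 0 c β Gβ)
      ≈⟨ +-cong (natK-onHead c α Gα) (natK-onHead c β Gβ) ⟩
    onHead 0# c α (λ α′ → shuffleCoeff γ α′ β) +ᴷ onHead 0# c β (λ β′ → shuffleCoeff γ α β′) ∎
    where
    Gα Gβ : List ℕ → ℕ
    Gα α′ = count γ (shuffle α′ β)
    Gβ β′ = count γ (shuffle α β′)

module MultipleSums {c ℓ : Level} (F : Field c ℓ) where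
  open Over F
  open FiniteSums F
  open CompositionSums F

  sumFin-comm₃ : ∀ nx ny nu (f : Fin nx → Fin ny → Fin nu → Carrier) →
    sumFin nx (λ x → sumFin ny (λ y → sumFin nu (f x y))) ≈ sumFin nu (λ u → sumFin nx (λ x → sumFin ny (λ y → f x y u)))
  sumFin-comm₃ nx ny nu f = ≈-trans (sumFin-cong nx (λ x → sumFin-comm ny nu (f x))) (sumFin-comm nx nu _)

  sumFin⁴-cong : ∀ nu nv nu′ nv′ {t s : Fin nu → Fin nv → Fin nu′ → Fin nv′ → Carrier} →
    (∀ u v u′ v′ → t u v u′ v′ ≈ s u v u′ v′) →
    sumFin nu (λ u → sumFin nv (λ v → sumFin nu′ (λ u′ → sumFin nv′ (t u v u′))))
    ≈ sumFin nu (λ u → sumFin nv (λ v → sumFin nu′ (λ u′ → sumFin nv′ (s u v u′))))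
  sumFin⁴-cong nu nv nu′ nv′ e =
    sumFin-cong nu (λ u → sumFin-cong nv (λ v → sumFin-cong nu′ (λ u′ → sumFin-cong nv′ (e u v u′))))

  sumFin⁴-zero : ∀ nu nv nu′ nv′ {t : Fin nu → Fin nv → Fin nu′ → Fin nv′ → Carrier} →
    (∀ u v u′ v′ → t u v u′ v′ ≈ 0#) → sumFin nu (λ u → sumFin nv (λ v → sumFin nu′ (λ u′ → sumFin nv′ (t u v u′)))) ≈ 0#
  sumFin⁴-zero nu nv nu′ nv′ e =
    sumFin-zero nu (λ u → sumFin-zero nv (λ v → sumFin-zero nu′ (λ u′ → sumFin-zero nv′ (e u v u′))))

  *-distribʳ-sumFin⁴ : ∀ nu nv nu′ nv′ (t : Fin nu → Fin nv → Fin nu′ → Fin nv′ → Carrier) w →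
    sumFin nu (λ u → sumFin nv (λ v → sumFin nu′ (λ u′ → sumFin nv′ (t u v u′)))) *ᴷ w
    ≈ sumFin nu (λ u → sumFin nv (λ v → sumFin nu′ (λ u′ → sumFin nv′ (λ v′ → t u v u′ v′ *ᴷ w))))
  *-distribʳ-sumFin⁴ nu nv nu′ nv′ t w = ≈-trans (*-distribʳ-sumFin nu w _) (sumFin-cong nu (λ u →
    ≈-trans (*-distribʳ-sumFin nv w _) (sumFin-cong nv (λ v →
    ≈-trans (*-distribʳ-sumFin nu′ w _) (sumFin-cong nu′ (λ u′ → *-distribʳ-sumFin nv′ w _))))))

  sumFin²-sumFin⁴-comm : ∀ nx ny nu nv nu′ nv′
    (G : Fin nx → Fin ny → Fin nu → Fin nv → Fin nu′ → Fin nv′ → Carrier) →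
    sumFin nx (λ x → sumFin ny (λ y →
      sumFin nu (λ u → sumFin nv (λ v → sumFin nu′ (λ u′ → sumFin nv′ (G x y u v u′))))))
    ≈ sumFin nu (λ u → sumFin nv (λ v → sumFin nu′ (λ u′ → sumFin nv′ (λ v′ →
      sumFin nx (λ x → sumFin ny (λ y → G x y u v u′ v′))))))
  sumFin²-sumFin⁴-comm nx ny nu nv nu′ nv′ G =
    ≈-trans (sumFin-comm₃ nx ny nu _) (sumFin-cong nu (λ u → ≈-trans (sumFin-comm₃ nx ny nv _) (sumFin-cong nv (λ v →
    ≈-trans (sumFin-comm₃ nx ny nu′ _) (sumFin-cong nu′ (λ u′ → sumFin-comm₃ nx ny nv′ _))))))

  sumFin²-factor : ∀ nx ny k (f h : Fin nx → Carrier) (g l : Fin ny → Carrier) →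
    sumFin nx (λ x → sumFin ny (λ y → (k *ᴷ f x *ᴷ g y) *ᴷ (h x *ᴷ l y)))
    ≈ k *ᴷ (sumFin nx (λ x → f x *ᴷ h x) *ᴷ sumFin ny (λ y → g y *ᴷ l y))
  sumFin²-factor nx ny k f h g l = ≈-sym (begin
    k *ᴷ (sumFin nx (λ x → f x *ᴷ h x) *ᴷ sumFin ny (λ y → g y *ᴷ l y))
      ≈⟨ ≈-trans (*-congˡ (*-distribʳ-sumFin nx _ _)) (*-distribˡ-sumFin nx k _) ⟩
    sumFin nx (λ x → k *ᴷ (f x *ᴷ h x *ᴷ sumFin ny (λ y → g y *ᴷ l y)))
      ≈⟨ sumFin-cong nx (λ x → ≈-trans (*-congˡ (*-distribˡ-sumFin ny _ _)) (*-distribˡ-sumFin ny k _)) ⟩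
    sumFin nx (λ x → sumFin ny (λ y → k *ᴷ (f x *ᴷ h x *ᴷ (g y *ᴷ l y))))
      ≈⟨ sumFin-cong nx (λ x → sumFin-cong ny (λ y → solve 5 (λ k f h g l →
           k :* (f :* h :* (g :* l)) := (k :* f :* g) :* (h :* l))
           ≈-refl k (f x) (h x) (g y) (l y))) ⟩
    sumFin nx (λ x → sumFin ny (λ y → (k *ᴷ f x *ᴷ g y) *ᴷ (h x *ᴷ l y))) ∎)

  sumFin⁴-factorˡ : ∀ nu nv nu′ nv′ (f : Fin nu → Fin nv → Carrier) (g : Fin nv → Fin nu′ → Fin nv′ → Carrier) →
    sumFin nu (λ u → sumFin nv (λ v → sumFin nu′ (λ u′ → sumFin nv′ (λ v′ → f u v *ᴷ g v u′ v′))))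
    ≈ sumFin nv (λ v → sumFin nu (λ u → f u v) *ᴷ sumFin nu′ (λ u′ → sumFin nv′ (g v u′)))
  sumFin⁴-factorˡ nu nv nu′ nv′ f g = begin
    sumFin nu (λ u → sumFin nv (λ v → sumFin nu′ (λ u′ → sumFin nv′ (λ v′ → f u v *ᴷ g v u′ v′))))
      ≈⟨ sumFin-cong nu (λ u → sumFin-cong nv (λ v →
           ≈-trans (sumFin-cong nu′ (λ u′ → ≈-sym (*-distribˡ-sumFin nv′ _ _))) (≈-sym (*-distribˡ-sumFin nu′ _ _)))) ⟩
    sumFin nu (λ u → sumFin nv (λ v → f u v *ᴷ sumFin nu′ (λ u′ → sumFin nv′ (g v u′))))
      ≈⟨ sumFin-comm nu nv _ ⟩
    sumFin nv (λ v → sumFin nu (λ u → f u v *ᴷ sumFin nu′ (λ u′ → sumFin nv′ (g v u′))))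
      ≈⟨ sumFin-cong nv (λ v → ≈-sym (*-distribʳ-sumFin nu _ _)) ⟩
    sumFin nv (λ v → sumFin nu (λ u → f u v) *ᴷ sumFin nu′ (λ u′ → sumFin nv′ (g v u′))) ∎

  sumFin⁴-factorʳ : ∀ nu nv nu′ nv′ (f : Fin nu′ → Fin nv′ → Carrier) (g : Fin nu → Fin nv → Fin nv′ → Carrier) →
    sumFin nu (λ u → sumFin nv (λ v → sumFin nu′ (λ u′ → sumFin nv′ (λ v′ → f u′ v′ *ᴷ g u v v′))))
    ≈ sumFin nv′ (λ v′ → sumFin nu′ (λ u′ → f u′ v′) *ᴷ sumFin nu (λ u → sumFin nv (λ v → g u v v′)))
  sumFin⁴-factorʳ nu nv nu′ nv′ f g = begin
    sumFin nu (λ u → sumFin nv (λ v → sumFin nu′ (λ u′ → sumFin nv′ (λ v′ → f u′ v′ *ᴷ g u v v′))))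
      ≈⟨ sumFin-cong nu (λ u → sumFin-cong nv (λ v → sumFin-comm nu′ nv′ _)) ⟩
    sumFin nu (λ u → sumFin nv (λ v → sumFin nv′ (λ v′ → sumFin nu′ (λ u′ → f u′ v′ *ᴷ g u v v′))))
      ≈⟨ sumFin-comm₃ nu nv nv′ _ ⟩
    sumFin nv′ (λ v′ → sumFin nu (λ u → sumFin nv (λ v → sumFin nu′ (λ u′ → f u′ v′ *ᴷ g u v v′))))
      ≈⟨ sumFin-cong nv′ (λ v′ → sumFin-cong nu (λ u → sumFin-cong nv (λ v → ≈-sym (*-distribʳ-sumFin nu′ _ _)))) ⟩
    sumFin nv′ (λ v′ → sumFin nu (λ u → sumFin nv (λ v → sumFin nu′ (λ u′ → f u′ v′) *ᴷ g u v v′)))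
      ≈⟨ sumFin-cong nv′ (λ v′ →
           ≈-trans (sumFin-cong nu (λ u → ≈-sym (*-distribˡ-sumFin nv _ _))) (≈-sym (*-distribˡ-sumFin nu _ _))) ⟩
    sumFin nv′ (λ v′ → sumFin nu′ (λ u′ → f u′ v′) *ᴷ sumFin nu (λ u → sumFin nv (λ v → g u v v′))) ∎

  sumFin-sumFin²-comm : ∀ nv nu′ nv′ (a : Fin nv → Carrier) (h : Fin nu′ → Fin nv′ → Carrier) (R : Fin nv → Fin nv′ → Carrier) →
    sumFin nv (λ v → a v *ᴷ sumFin nu′ (λ u′ → sumFin nv′ (λ v′ → h u′ v′ *ᴷ R v v′)))
    ≈ sumFin nu′ (λ u′ → sumFin nv′ (λ v′ → h u′ v′ *ᴷ sumFin nv (λ v → a v *ᴷ R v v′)))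
  sumFin-sumFin²-comm nv nu′ nv′ a h R = begin
    sumFin nv (λ v → a v *ᴷ sumFin nu′ (λ u′ → sumFin nv′ (λ v′ → h u′ v′ *ᴷ R v v′)))
      ≈⟨ sumFin-cong nv (λ v → ≈-trans (*-distribˡ-sumFin nu′ _ _) (sumFin-cong nu′ (λ u′ → *-distribˡ-sumFin nv′ _ _))) ⟩
    sumFin nv (λ v → sumFin nu′ (λ u′ → sumFin nv′ (λ v′ → a v *ᴷ (h u′ v′ *ᴷ R v v′))))
      ≈⟨ ≈-trans (sumFin-comm nv nu′ _) (sumFin-cong nu′ (λ u′ → sumFin-comm nv nv′ _)) ⟩
    sumFin nu′ (λ u′ → sumFin nv′ (λ v′ → sumFin nv (λ v → a v *ᴷ (h u′ v′ *ᴷ R v v′))))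
      ≈⟨ sumFin-cong nu′ (λ u′ → sumFin-cong nv′ (λ v′ →
           ≈-trans (sumFin-cong nv (λ v → *-leftSwap _ _ _)) (≈-sym (*-distribˡ-sumFin nv _ _)))) ⟩
    sumFin nu′ (λ u′ → sumFin nv′ (λ v′ → h u′ v′ *ᴷ sumFin nv (λ v → a v *ᴷ R v v′))) ∎

  sumFin²-sumList²-comm : ∀ nu nv A B (h : Fin nu → Fin nv → Carrier) (f : List ℕ → Carrier)
    (g : List ℕ → Fin nv → Carrier) (N : List ℕ → List ℕ → Carrier) →
    sumFin nu (λ u → sumFin nv (λ v → h u v *ᴷ sumList A (λ α → sumList B (λ β → f α *ᴷ g β v *ᴷ N α β))))
    ≈ sumList A (λ α → f α *ᴷ sumList B (λ β → sumFin nu (λ u → sumFin nv (λ v → h u v *ᴷ g β v)) *ᴷ N α β))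
  sumFin²-sumList²-comm nu nv A B h f g N = begin
    sumFin nu (λ u → sumFin nv (λ v → h u v *ᴷ sumList A (λ α → sumList B (λ β → f α *ᴷ g β v *ᴷ N α β))))
      ≈⟨ sumFin-cong nu (λ u → sumFin-cong nv (λ v →
           ≈-trans (*-distribˡ-sumList A _ _) (sumList-cong A (λ α → *-distribˡ-sumList B _ _)))) ⟩
    sumFin nu (λ u → sumFin nv (λ v → sumList A (λ α → sumList B (λ β → h u v *ᴷ (f α *ᴷ g β v *ᴷ N α β)))))
      ≈⟨ sumFin-cong nu (λ u → ≈-trans (sumFin-sumList-comm nv A _) (sumList-cong A (λ α → sumFin-sumList-comm nv B _))) ⟩
    sumFin nu (λ u → sumList A (λ α → sumList B (λ β → sumFin nv (λ v → h u v *ᴷ (f α *ᴷ g β v *ᴷ N α β)))))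
      ≈⟨ ≈-trans (sumFin-sumList-comm nu A _) (sumList-cong A (λ α → sumFin-sumList-comm nu B _)) ⟩
    sumList A (λ α → sumList B (λ β → sumFin nu (λ u → sumFin nv (λ v → h u v *ᴷ (f α *ᴷ g β v *ᴷ N α β)))))
      ≈⟨ sumList-cong A (λ α → sumList-cong B (λ β → sumFin-cong nu (λ u → sumFin-cong nv (λ v →
           solve 4 (λ h f g n → h :* (f :* g :* n) := f :* ((h :* g) :* n))
             ≈-refl (h u v) (f α) (g β v) (N α β))))) ⟩
    sumList A (λ α → sumList B (λ β → sumFin nu (λ u → sumFin nv (λ v → f α *ᴷ ((h u v *ᴷ g β v) *ᴷ N α β)))))
      ≈⟨ sumList-cong A (λ α → sumList-cong B (λ β →
           ≈-trans (sumFin-cong nu (λ u → ≈-sym (*-distribˡ-sumFin nv _ _))) (≈-sym (*-distribˡ-sumFin nu _ _)))) ⟩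
    sumList A (λ α → sumList B (λ β → f α *ᴷ sumFin nu (λ u → sumFin nv (λ v → (h u v *ᴷ g β v) *ᴷ N α β))))
      ≈⟨ sumList-cong A (λ α → ≈-trans (≈-sym (*-distribˡ-sumList B _ _)) (*-congˡ (sumList-cong B (λ β →
           ≈-trans (sumFin-cong nu (λ u → ≈-sym (*-distribʳ-sumFin nv _ _))) (≈-sym (*-distribʳ-sumFin nu _ _)))))) ⟩
    sumList A (λ α → f α *ᴷ sumList B (λ β → sumFin nu (λ u → sumFin nv (λ v → h u v *ᴷ g β v)) *ᴷ N α β)) ∎

  sumFin²-sumList²-comm′ : ∀ nu nv A B (h : Fin nu → Fin nv → Carrier) (f : List ℕ → Carrier)
    (g : List ℕ → Fin nv → Carrier) (N : List ℕ → List ℕ → Carrier) →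
    sumFin nu (λ u → sumFin nv (λ v → h u v *ᴷ sumList A (λ α → sumList B (λ β → g α v *ᴷ f β *ᴷ N α β))))
    ≈ sumList B (λ β → f β *ᴷ sumList A (λ α → sumFin nu (λ u → sumFin nv (λ v → h u v *ᴷ g α v)) *ᴷ N α β))
  sumFin²-sumList²-comm′ nu nv A B h f g N = ≈-trans
    (sumFin-cong nu (λ u → sumFin-cong nv (λ v → *-congˡ (≈-trans (sumList-comm A B _)
      (sumList-cong B (λ β → sumList-cong A (λ α → *-congʳ (*-comm _ _))))))))
    (sumFin²-sumList²-comm nu nv B A h f g (λ β α → N α β))

  sumFin⁴-reassoc : ∀ nX ny ni nx (C : Fin nX → Fin ny → Carrier) (Z : Fin ni → Carrier)
    (D : Fin nX → Fin ni → Fin nx → Carrier) (A : Fin nx → Carrier) (B : Fin ny → Carrier) →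
    sumFin nX (λ X → sumFin ny (λ y → C X y *ᴷ (sumFin ni (λ i → Z i *ᴷ sumFin nx (λ x → D X i x *ᴷ A x)) *ᴷ B y)))
    ≈ sumFin ni (λ i → Z i *ᴷ sumFin nx (λ x → sumFin ny (λ y → sumFin nX (λ X → C X y *ᴷ D X i x) *ᴷ (A x *ᴷ B y))))
  sumFin⁴-reassoc nX ny ni nx C Z D A B = begin
    sumFin nX (λ X → sumFin ny (λ y → C X y *ᴷ (sumFin ni (λ i → Z i *ᴷ sumFin nx (λ x → D X i x *ᴷ A x)) *ᴷ B y)))
      ≈⟨ sumFin-cong nX (λ X → sumFin-cong ny (λ y → expand X y)) ⟩
    sumFin nX (λ X → sumFin ny (λ y → sumFin ni (λ i → sumFin nx (λ x → t X y i x))))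
      ≈⟨ sumFin-cong nX (λ X → ≈-trans (sumFin-comm ny ni _) (sumFin-cong ni (λ i → sumFin-comm ny nx _))) ⟩
    sumFin nX (λ X → sumFin ni (λ i → sumFin nx (λ x → sumFin ny (λ y → t X y i x))))
      ≈⟨ ≈-trans (sumFin-comm nX ni _) (sumFin-cong ni (λ i → sumFin-comm nX nx _)) ⟩
    sumFin ni (λ i → sumFin nx (λ x → sumFin nX (λ X → sumFin ny (λ y → t X y i x))))
      ≈⟨ sumFin-cong ni (λ i → sumFin-cong nx (λ x → sumFin-comm nX ny _)) ⟩
    sumFin ni (λ i → sumFin nx (λ x → sumFin ny (λ y → sumFin nX (λ X → t X y i x))))
      ≈⟨ sumFin-cong ni (λ i → sumFin-cong nx (λ x → sumFin-cong ny (λ y → factor y i x))) ⟩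
    sumFin ni (λ i → sumFin nx (λ x → sumFin ny (λ y → Z i *ᴷ (sumFin nX (λ X → C X y *ᴷ D X i x) *ᴷ (A x *ᴷ B y)))))
      ≈⟨ sumFin-cong ni (λ i → ≈-trans (sumFin-cong nx (λ x → ≈-sym (*-distribˡ-sumFin ny (Z i) _)))
                                       (≈-sym (*-distribˡ-sumFin nx (Z i) _))) ⟩
    sumFin ni (λ i → Z i *ᴷ sumFin nx (λ x → sumFin ny (λ y → sumFin nX (λ X → C X y *ᴷ D X i x) *ᴷ (A x *ᴷ B y)))) ∎
    where
    t : Fin nX → Fin ny → Fin ni → Fin nx → Carrier
    t X y i x = C X y *ᴷ ((Z i *ᴷ (D X i x *ᴷ A x)) *ᴷ B y)
    expand : ∀ X y → C X y *ᴷ (sumFin ni (λ i → Z i *ᴷ sumFin nx (λ x → D X i x *ᴷ A x)) *ᴷ B y)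
                     ≈ sumFin ni (λ i → sumFin nx (λ x → t X y i x))
    expand X y = ≈-trans (*-congˡ (*-distribʳ-sumFin ni (B y) _)) (≈-trans (*-distribˡ-sumFin ni (C X y) _)
      (sumFin-cong ni (λ i → ≈-trans (*-congˡ (≈-trans (*-congʳ (*-distribˡ-sumFin nx (Z i) _))
                                                        (*-distribʳ-sumFin nx (B y) _)))
                                     (*-distribˡ-sumFin nx (C X y) _))))
    factor : ∀ y i x → sumFin nX (λ X → t X y i x) ≈ Z i *ᴷ (sumFin nX (λ X → C X y *ᴷ D X i x) *ᴷ (A x *ᴷ B y))
    factor y i x = begin
      sumFin nX (λ X → t X y i x)
        ≈⟨ sumFin-cong nX (λ X → solve 5 (λ c z d a b →
             c :* ((z :* (d :* a)) :* b) := z :* ((c :* d) :* (a :* b)))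
             ≈-refl (C X y) (Z i) (D X i x) (A x) (B y)) ⟩
      sumFin nX (λ X → Z i *ᴷ ((C X y *ᴷ D X i x) *ᴷ (A x *ᴷ B y)))
        ≈⟨ ≈-trans (≈-sym (*-distribˡ-sumFin nX (Z i) _)) (*-congˡ (≈-sym (*-distribʳ-sumFin nX _ _))) ⟩
      Z i *ᴷ (sumFin nX (λ X → C X y *ᴷ D X i x) *ᴷ (A x *ᴷ B y)) ∎

-- Graded linear algebra and the coefficients ξ^{⊗ℓ(γ)} Δ_γ

module GradedLinear {c ℓ : Level} (F : Field c ℓ) (H : Over.GradedData F) where
  open Over F
  open FiniteSums F
  open GradedData H
  open Ops H

  basis-diag : ∀ {n} (i : Fin (dim n)) → basis i i ≈ 1#
  basis-diag i with i Fin.≟ i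
  ... | yes _   = ≈-refl
  ... | no  i≢i = ⊥-elim (i≢i refl)

  basis-offdiag : ∀ {n} (i j : Fin (dim n)) → i ≢ j → basis i j ≈ 0#
  basis-offdiag i j i≢j with i Fin.≟ j
  ... | yes i≡j = ⊥-elim (i≢j i≡j)
  ... | no  _   = ≈-refl

  sumFin-basisˡ : ∀ {n} (i : Fin (dim n)) (f : Fin (dim n) → Carrier) → sumFin (dim n) (λ j → basis i j *ᴷ f j) ≈ f i
  sumFin-basisˡ {n} i f =
    ≈-trans (sumFin-select (dim n) i _ (λ j i≢j → ≈-trans (*-congʳ (basis-offdiag i j i≢j)) (zeroˡ _)))
            (≈-trans (*-congʳ (basis-diag i)) (*-identityˡ _))

  sumFin-basisʳ : ∀ {n} (i : Fin (dim n)) (f : Fin (dim n) → Carrier) → sumFin (dim n) (λ j → f j *ᴷ basis j i) ≈ f i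
  sumFin-basisʳ {n} i f =
    ≈-trans (sumFin-select (dim n) i _ (λ j i≢j → ≈-trans (*-congˡ (basis-offdiag j i (λ e → i≢j (≡.sym e)))) (zeroʳ _)))
            (≈-trans (*-congˡ (basis-diag i)) (*-identityʳ _))

  cast-refl : ∀ n (a : V n) → cast n n a ≈v a
  cast-refl n a i with n ≟ n
  ... | yes refl = ≈-refl
  ... | no  n≢n  = ⊥-elim (n≢n refl)

  cast-≢ : ∀ m n (a : V m) → m ≢ n → cast m n a ≈v zeroV
  cast-≢ m n a m≢n i with m ≟ n
  ... | yes m≡n = ⊥-elim (m≢n m≡n)
  ... | no  _   = ≈-refl

  cast-cong : ∀ m n {a b : V m} → a ≈v b → cast m n a ≈v cast m n b
  cast-cong m n a≈b i with m ≟ n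
  ... | yes refl = a≈b i
  ... | no  _    = ≈-refl

  cast-linear : ∀ m n (a : V m) k → cast m n a k ≈ sumFin (dim m) (λ l → a l *ᴷ cast m n (basis l) k)
  cast-linear m n a k with m ≟ n
  ... | yes refl = ≈-sym (sumFin-basisʳ k a)
  ... | no  _    = ≈-sym (sumFin-zero (dim m) (λ l → zeroʳ _))

  cast-cast : ∀ {l m} n → l ≡ m → (a : V l) → cast m n (cast l m a) ≈v cast l n a
  cast-cast {l} n refl a = cast-cong l n (cast-refl l a)

  cast-invariant : ∀ {m n} → m ≡ n → (G : ∀ k → V k → Carrier) → (∀ k {a b : V k} → a ≈v b → G k a ≈ G k b) →
                   (a : V m) → G m a ≈ G n (cast m n a)
  cast-invariant {m} refl G G-cong a = G-cong m (λ i → ≈-sym (cast-refl m a i))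

  cop-cong : ∀ p q {a b : V (p + q)} → a ≈v b → ∀ i j → cop p q a i j ≈ cop p q b i j
  cop-cong p q a≈b i j = sumFin-cong (dim (p + q)) (λ k → *-congʳ (a≈b k))

  cop-basis : ∀ p q k i j → cop p q (basis k) i j ≈ δ p q k i j
  cop-basis p q k i j = sumFin-basisˡ k (λ l → δ p q l i j)

  cop-zero : ∀ p q (a : V (p + q)) → a ≈v zeroV → ∀ i j → cop p q a i j ≈ 0#
  cop-zero p q a a≈0 i j = sumFin-zero (dim (p + q)) (λ k → ≈-trans (*-congʳ (a≈0 k)) (zeroˡ _))

  applyF-cong : ∀ (f : Functional) n {a b : V n} → a ≈v b → applyF f n a ≈ applyF f n b
  applyF-cong f n a≈b = sumFin-cong (dim n) (λ k → *-congʳ (a≈b k))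

  applyF-basis : ∀ (f : Functional) n i → applyF f n (basis i) ≈ f n i
  applyF-basis f n i = sumFin-basisˡ i (f n)

  epsV-cong : ∀ {a b : V 0} → a ≈v b → epsV a ≈ epsV b
  epsV-cong a≈b = sumFin-cong (dim 0) (λ k → *-congʳ (a≈b k))

  epsN-cong : ∀ n {a b : V n} → a ≈v b → epsN n a ≈ epsN n b
  epsN-cong n a≈b = epsV-cong (cast-cong n 0 a≈b)

  epsV-zero : epsV zeroV ≈ 0#
  epsV-zero = sumFin-zero (dim 0) (λ k → zeroˡ _)

  epsV-basis : ∀ i → epsV (basis i) ≈ ε i
  epsV-basis i = sumFin-basisˡ i ε

  epsN-≢0 : ∀ n (a : V n) → n ≢ 0 → epsN n a ≈ 0#
  epsN-≢0 n a n≢0 = ≈-trans (epsV-cong (cast-≢ n 0 a n≢0)) epsV-zero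

  mul-basisʳ : ∀ {p q} (a : V p) (j : Fin (dim q)) k → mul a (basis j) k ≈ sumFin (dim p) (λ i → a i *ᴷ μ p q i j k)
  mul-basisʳ {p} {q} a j k = sumFin-cong (dim p) (λ i →
    ≈-trans (sumFin-cong (dim q) (λ l → ≈-trans (*-assoc _ _ _) (*-leftSwap (a i) (basis j l) _)))
            (sumFin-basisˡ j (λ l → a i *ᴷ μ p q i l k)))

  mul-basisˡ : ∀ {p q} (i : Fin (dim p)) (b : V q) k → mul (basis i) b k ≈ sumFin (dim q) (λ j → b j *ᴷ μ p q i j k)
  mul-basisˡ {p} {q} i b k = ≈-trans
    (sumFin-cong (dim p) (λ l → ≈-trans (sumFin-cong (dim q) (λ j → *-assoc _ _ _)) (≈-sym (*-distribˡ-sumFin (dim q) _ _))))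
    (sumFin-basisˡ i (λ l → sumFin (dim q) (λ j → b j *ᴷ μ p q l j k)))

  castT-refl : ∀ p q (W : T p q) i j → castT p q p q W i j ≈ W i j
  castT-refl p q W i j with p ≟ p | q ≟ q
  ... | yes refl | yes refl = ≈-refl
  ... | no  p≢p  | _        = ⊥-elim (p≢p refl)
  ... | yes refl | no  q≢q  = ⊥-elim (q≢q refl)

  cast-pairing-linear : ∀ n m (h : V n) (w : Fin (dim m) → Carrier) →
    sumFin (dim m) (λ i → cast n m h i *ᴷ w i)
    ≈ sumFin (dim n) (λ k → h k *ᴷ sumFin (dim m) (λ i → cast n m (basis k) i *ᴷ w i))
  cast-pairing-linear n m h w = ≈-trans (sumFin-cong (dim m) (λ i → *-congʳ (cast-linear n m h i)))
                                        (sumFin-matrix-assoc (dim n) (dim m) h _ w)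

module Coefficients {c ℓ : Level} (F : Field c ℓ) (H : Over.GradedData F) (hH : Over.IsConnectedHopf F H)
                    (ξ : Over.Ops.Functional F H) where
  open Over F
  open FiniteSums F
  open GradedData H
  open Ops H
  open MultipleSums F using (sumFin⁴-reassoc)
  open GradedLinear F H
  open IsConnectedHopf hH

  ξΔ : List ℕ → (n : ℕ) → V n → Carrier
  ξΔ = xiΔ H ξ

  ξΔ-cong : ∀ γ n {a b : V n} → a ≈v b → ξΔ γ n a ≈ ξΔ γ n b
  ξΔ-cong []          n a≈b = epsN-cong n a≈b
  ξΔ-cong (a ∷ [])    n a≈b = applyF-cong ξ a (cast-cong n a a≈b)
  ξΔ-cong (a ∷ b ∷ β) n a≈b = sumFin-cong (dim a) (λ i → *-congˡ
    (ξΔ-cong (b ∷ β) (n ∸ a) (λ j → cop-cong a (n ∸ a) (cast-cong n (a + (n ∸ a)) a≈b) i j)))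

  ξΔ-linear : ∀ γ n (h : V n) → ξΔ γ n h ≈ sumFin (dim n) (λ k → h k *ᴷ ξΔ γ n (basis k))
  ξΔ-linear []          n h = cast-pairing-linear n 0 h ε
  ξΔ-linear (a ∷ [])    n h = cast-pairing-linear n a h (ξ a)
  ξΔ-linear (a ∷ b ∷ β) n h = begin
    sumFin (dim a) (λ i → ξ a i *ᴷ ξΔ (b ∷ β) m (W h i))
      ≈⟨ sumFin-cong (dim a) (λ i → *-congˡ (≈-trans (ξΔ-linear (b ∷ β) m (W h i))
           (sumFin-cong (dim m) (λ j → *-congʳ (cast-pairing-linear n (a + m) h (λ l → δ a m l i j)))))) ⟩
    sumFin (dim a) (λ i → ξ a i *ᴷ sumFin (dim m) (λ j → sumFin (dim n) (λ k → h k *ᴷ W (basis k) i j) *ᴷ Q j))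
      ≈⟨ sumFin-cong (dim a) (λ i → *-congˡ (sumFin-matrix-assoc (dim n) (dim m) h _ Q)) ⟩
    sumFin (dim a) (λ i → ξ a i *ᴷ sumFin (dim n) (λ k → h k *ᴷ R k i))
      ≈⟨ sumFin-cong (dim a) (λ i → *-comm _ _) ⟩
    sumFin (dim a) (λ i → sumFin (dim n) (λ k → h k *ᴷ R k i) *ᴷ ξ a i)
      ≈⟨ sumFin-matrix-assoc (dim n) (dim a) h R (ξ a) ⟩
    sumFin (dim n) (λ k → h k *ᴷ sumFin (dim a) (λ i → R k i *ᴷ ξ a i))
      ≈⟨ sumFin-cong (dim n) (λ k → *-congˡ (sumFin-cong (dim a) (λ i →
           ≈-trans (*-comm _ _) (*-congˡ (≈-sym (ξΔ-linear (b ∷ β) m (W (basis k) i))))))) ⟩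
    sumFin (dim n) (λ k → h k *ᴷ ξΔ (a ∷ b ∷ β) n (basis k)) ∎
    where
    m = n ∸ a
    W : V n → Fin (dim a) → V m
    W v i = cop a m (cast n (a + m) v) i
    Q : Fin (dim m) → Carrier
    Q j = ξΔ (b ∷ β) m (basis j)
    R : Fin (dim n) → Fin (dim a) → Carrier
    R k i = sumFin (dim m) (λ j → W (basis k) i j *ᴷ Q j)

  ξΔ-∷ : ∀ a γ m (h : V (a + m)) → ξΔ (a ∷ γ) (a + m) h ≈ sumFin (dim a) (λ i → ξ a i *ᴷ ξΔ γ m (cop a m h i))
  ξΔ-∷ a (b ∷ β) m h = ≈-trans (degree-irrelevant ((a + m) ∸ a) (ℕ.m+n∸m≡n a m))
    (sumFin-cong (dim a) (λ i → *-congˡ (ξΔ-cong (b ∷ β) m (λ j → cop-cong a m (cast-refl (a + m) h) i j))))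
    where
    degree-irrelevant : ∀ k → k ≡ m →
      sumFin (dim a) (λ i → ξ a i *ᴷ ξΔ (b ∷ β) k (cop a k (cast (a + m) (a + k) h) i))
      ≈ sumFin (dim a) (λ i → ξ a i *ᴷ ξΔ (b ∷ β) m (cop a m (cast (a + m) (a + m) h) i))
    degree-irrelevant k refl = ≈-refl
  ξΔ-∷ a [] zero h = begin
    sumFin (dim a) (λ i → cast (a + 0) a h i *ᴷ ξ a i)
      ≈⟨ sumFin-cong (dim a) (λ i → *-comm _ _) ⟩
    sumFin (dim a) (λ i → ξ a i *ᴷ cast (a + 0) a h i)
      ≈⟨ sumFin-cong (dim a) (λ i → *-congˡ (≈-sym (≈-trans (epsV-cong (λ j → cop-cong a 0 h≈ i j))
                                                             (counitʳ a (cast (a + 0) a h) i)))) ⟩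
    sumFin (dim a) (λ i → ξ a i *ᴷ epsV (λ j → cop a 0 h i j)) ∎
    where
    h≈ : h ≈v cast a (a + 0) (cast (a + 0) a h)
    h≈ k = ≈-sym (≈-trans (cast-cast (a + 0) (ℕ.+-identityʳ a) h k) (cast-refl (a + 0) h k))
  ξΔ-∷ a [] (suc m) h = ≈-trans
    (sumFin-zero (dim a) (λ i → ≈-trans (*-congʳ (cast-≢ (a + suc m) a h (ℕ.m+1+n≢m a) i)) (zeroˡ _)))
    (≈-sym (sumFin-zero (dim a) (λ i → ≈-trans (*-congˡ epsV-zero) (zeroʳ _))))

  ξΔ-++ : ∀ {p α} → α ⊨ p → ∀ q β (h : V (p + q)) →
    ξΔ (α ++ β) (p + q) h
    ≈ sumFin (dim p) (λ x → sumFin (dim q) (λ y → cop p q h x y *ᴷ (ξΔ α p (basis x) *ᴷ ξΔ β q (basis y))))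
  ξΔ-++ [] q β h = ≈-sym (begin
    sumFin (dim 0) (λ x → sumFin (dim q) (λ y → cop 0 q h x y *ᴷ (epsV (basis x) *ᴷ B y)))
      ≈⟨ sumFin-cong (dim 0) (λ x → sumFin-cong (dim q) (λ y →
           ≈-trans (*-congˡ (*-congʳ (epsV-basis x))) (≈-sym (*-assoc _ _ _)))) ⟩
    sumFin (dim 0) (λ x → sumFin (dim q) (λ y → cop 0 q h x y *ᴷ ε x *ᴷ B y))
      ≈⟨ sumFin-comm (dim 0) (dim q) _ ⟩
    sumFin (dim q) (λ y → sumFin (dim 0) (λ x → cop 0 q h x y *ᴷ ε x *ᴷ B y))
      ≈⟨ sumFin-cong (dim q) (λ y → ≈-trans (≈-sym (*-distribʳ-sumFin (dim 0) (B y) _)) (*-congʳ (counitˡ q h y))) ⟩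
    sumFin (dim q) (λ y → h y *ᴷ B y)
      ≈⟨ ≈-sym (ξΔ-linear β q h) ⟩
    ξΔ β q h ∎)
    where
    B : Fin (dim q) → Carrier
    B y = ξΔ β q (basis y)
  ξΔ-++ (_∷_ a {α′} {p′} α′⊨p′) q β h = begin
    ξΔ (c₁ ∷ (α′ ++ β)) ((c₁ + p′) + q) h
      ≈⟨ cast-invariant (ℕ.+-assoc c₁ p′ q) (ξΔ (c₁ ∷ (α′ ++ β))) (ξΔ-cong (c₁ ∷ (α′ ++ β))) h ⟩
    ξΔ (c₁ ∷ (α′ ++ β)) (c₁ + (p′ + q)) h′
      ≈⟨ ξΔ-∷ c₁ (α′ ++ β) (p′ + q) h′ ⟩
    sumFin (dim c₁) (λ i → ξ c₁ i *ᴷ ξΔ (α′ ++ β) (p′ + q) (cop c₁ (p′ + q) h′ i))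
      ≈⟨ sumFin-cong (dim c₁) (λ i → *-congˡ (ξΔ-++ α′⊨p′ q β (cop c₁ (p′ + q) h′ i))) ⟩
    sumFin (dim c₁) (λ i → ξ c₁ i *ᴷ sumFin (dim p′) (λ x → sumFin (dim q) (λ y →
       cop p′ q (cop c₁ (p′ + q) h′ i) x y *ᴷ (A x *ᴷ B y))))
      ≈⟨ sumFin-cong (dim c₁) (λ i → *-congˡ (sumFin-cong (dim p′) (λ x → sumFin-cong (dim q) (λ y →
           *-congʳ (≈-sym (coassociative i x y)))))) ⟩
    sumFin (dim c₁) (λ i → ξ c₁ i *ᴷ sumFin (dim p′) (λ x → sumFin (dim q) (λ y →
       sumFin (dim (c₁ + p′)) (λ X → cop (c₁ + p′) q h X y *ᴷ D X i x) *ᴷ (A x *ᴷ B y))))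
      ≈⟨ ≈-sym (sumFin⁴-reassoc (dim (c₁ + p′)) (dim q) (dim c₁) (dim p′) (cop (c₁ + p′) q h) (ξ c₁) D A B) ⟩
    sumFin (dim (c₁ + p′)) (λ X → sumFin (dim q) (λ y → cop (c₁ + p′) q h X y *ᴷ
       ((sumFin (dim c₁) (λ i → ξ c₁ i *ᴷ sumFin (dim p′) (λ x → D X i x *ᴷ A x))) *ᴷ B y)))
      ≈⟨ sumFin-cong (dim (c₁ + p′)) (λ X → sumFin-cong (dim q) (λ y → *-congˡ (*-congʳ (≈-sym (head-part X))))) ⟩
    sumFin (dim (c₁ + p′)) (λ X → sumFin (dim q) (λ y →
       cop (c₁ + p′) q h X y *ᴷ (ξΔ (c₁ ∷ α′) (c₁ + p′) (basis X) *ᴷ B y))) ∎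
    where
    c₁ = suc a
    h′ : V (c₁ + (p′ + q))
    h′ = cast ((c₁ + p′) + q) (c₁ + (p′ + q)) h
    A : Fin (dim p′) → Carrier
    A x = ξΔ α′ p′ (basis x)
    B : Fin (dim q) → Carrier
    B y = ξΔ β q (basis y)
    D : Fin (dim (c₁ + p′)) → Fin (dim c₁) → Fin (dim p′) → Carrier
    D X = cop c₁ p′ (basis X)
    head-part : ∀ X → ξΔ (c₁ ∷ α′) (c₁ + p′) (basis X)
                      ≈ sumFin (dim c₁) (λ i → ξ c₁ i *ᴷ sumFin (dim p′) (λ x → D X i x *ᴷ A x))
    head-part X = ≈-trans (ξΔ-∷ c₁ α′ p′ (basis X)) (sumFin-cong (dim c₁) (λ i → *-congˡ (ξΔ-linear α′ p′ _)))
    coassociative : ∀ i x y → sumFin (dim (c₁ + p′)) (λ X → cop (c₁ + p′) q h X y *ᴷ D X i x)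
                              ≈ cop p′ q (cop c₁ (p′ + q) h′ i) x y
    coassociative i x y = ≈-trans (sumFin-cong (dim (c₁ + p′)) (λ X → *-congˡ (cop-basis c₁ p′ X i x)))
                                  (coassoc c₁ p′ q h i x y)
-- The shuffle algebra; Ψ is a coalgebra map

compAt-⊨ : ∀ {c ℓ} (F : Field c ℓ) n k → Over.compAt F n k ⊨ n
compAt-⊨ F n k = All.lookup (comps-sound n) (∈-lookup k)

module ShuffleAlgebra {c ℓ : Level} (F : Field c ℓ) where
  open Over F
  open FiniteSums F
  module Sh = Ops Sh

  singletonIndex : ∀ n → Fin (length (comps (suc n)))
  singletonIndex n = proj₁ (indexOf (⊨-singleton n))

  concatIndex : ∀ p q → Fin (length (comps p)) → Fin (length (comps q)) → Fin (length (comps (p + q)))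
  concatIndex p q u v = proj₁ (indexOf (⊨-++ (compAt-⊨ F p u) (compAt-⊨ F q v)))

  sumFin-comps-select : ∀ n {γ} → γ ⊨ n → (k : Fin (length (comps n))) → compAt n k ≡ γ →
    (v ind : Fin (length (comps n)) → Carrier) → (∀ w → compAt n w ≢ γ → ind w ≈ 0#) → ind k ≈ 1# →
    sumFin (length (comps n)) (λ w → v w *ᴷ ind w) ≈ v k
  sumFin-comps-select n γ⊨n k k↦γ v ind ind≈0 ind≈1 = ≈-trans
    (sumFin-select _ k _ (λ w k≢w → ≈-trans (*-congˡ (ind≈0 w (λ w↦γ → k≢w (index-unique γ⊨n k w k↦γ w↦γ)))) (zeroʳ _)))
    (≈-trans (*-congˡ ind≈1) (*-identityʳ _))

  Sh-cop : ∀ p q (v : Sh.V (p + q)) u w → Sh.cop p q v u w ≈ v (concatIndex p q u w)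
  Sh-cop p q v u w = sumFin-comps-select (p + q) (⊨-++ (compAt-⊨ F p u) (compAt-⊨ F q w)) k k↦αβ v
    (λ l → GradedData.δ Sh p q l u w) δ≈0 δ≈1
    where
    k = concatIndex p q u w
    k↦αβ = proj₂ (indexOf (⊨-++ (compAt-⊨ F p u) (compAt-⊨ F q w)))
    αβ = compAt p u ++ compAt q w
    δ≈0 : ∀ l → compAt (p + q) l ≢ αβ → GradedData.δ Sh p q l u w ≈ 0#
    δ≈0 l l↛αβ with ≡-dec _≟_ (compAt (p + q) l) αβ
    ... | yes l↦αβ = ⊥-elim (l↛αβ l↦αβ)
    ... | no  _    = ≈-refl
    δ≈1 : GradedData.δ Sh p q k u w ≈ 1#
    δ≈1 with ≡-dec _≟_ (compAt (p + q) k) αβ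
    ... | yes _    = ≈-refl
    ... | no  k↛αβ = ⊥-elim (k↛αβ k↦αβ)

  ξS-applyF : ∀ n (v : Sh.V (suc n)) → Sh.applyF ξS (suc n) v ≈ v (singletonIndex n)
  ξS-applyF n v = sumFin-comps-select (suc n) (⊨-singleton n) k k↦[n] v (ξS (suc n)) ξS≈0 ξS≈1
    where
    k = singletonIndex n
    k↦[n] = proj₂ (indexOf (⊨-singleton n))
    ξS≈0 : ∀ l → compAt (suc n) l ≢ suc n ∷ [] → ξS (suc n) l ≈ 0#
    ξS≈0 l l↛[n] with length (compAt (suc n) l) ≟ 1
    ... | yes length≡1 = ⊥-elim (l↛[n] (singleton-⊨ (compAt-⊨ F (suc n) l) length≡1))
    ... | no  _        = ≈-refl
    ξS≈1 : ξS (suc n) k ≈ 1#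
    ξS≈1 with length (compAt (suc n) k) ≟ 1
    ... | yes _          = ≈-refl
    ... | no  length≢1   = ⊥-elim (length≢1 (cong length k↦[n]))

module CoalgebraMap {c ℓ : Level} (F : Field c ℓ) (H : Over.GradedData F) (hH : Over.IsConnectedHopf F H)
                    (ξ : Over.Ops.Functional F H) where
  open Over F
  open FiniteSums F
  open GradedData H
  open Ops H
  open GradedLinear F H
  open Coefficients F H hH ξ
  open ShuffleAlgebra F
  open IsConnectedHopf hH

  Ψ : GradedMap H Sh
  Ψ n i k = ξΔ (compAt n k) n (basis i)

  Ψ-cop : ∀ p q k u v → Sh.cop p q (Ψ (p + q) k) u v
          ≈ sumFin (dim p) (λ x → sumFin (dim q) (λ y → δ p q k x y *ᴷ Ψ p x u *ᴷ Ψ q y v))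
  Ψ-cop p q k u v = begin
    Sh.cop p q (Ψ (p + q) k) u v
      ≈⟨ Sh-cop p q (Ψ (p + q) k) u v ⟩
    ξΔ (compAt (p + q) (concatIndex p q u v)) (p + q) (basis k)
      ≈⟨ ≡⇒≈ (cong (λ γ → ξΔ γ (p + q) (basis k)) (proj₂ (indexOf (⊨-++ (compAt-⊨ F p u) (compAt-⊨ F q v))))) ⟩
    ξΔ (compAt p u ++ compAt q v) (p + q) (basis k)
      ≈⟨ ξΔ-++ (compAt-⊨ F p u) q (compAt q v) (basis k) ⟩
    sumFin (dim p) (λ x → sumFin (dim q) (λ y → cop p q (basis k) x y *ᴷ (Ψ p x u *ᴷ Ψ q y v)))
      ≈⟨ sumFin-cong (dim p) (λ x → sumFin-cong (dim q) (λ y →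
           ≈-trans (*-congʳ (cop-basis p q k x y)) (≈-sym (*-assoc _ _ _)))) ⟩
    sumFin (dim p) (λ x → sumFin (dim q) (λ y → δ p q k x y *ᴷ Ψ p x u *ᴷ Ψ q y v)) ∎

  Ψ-ε : ∀ i → Sh.epsV (Ψ 0 i) ≈ ε i
  Ψ-ε i = ≈-trans (+-identityʳ _) (≈-trans (*-identityʳ _) (epsV-basis i))

  Ψ-isCoalgebraMap : IsCoalgebraMap H Sh Ψ
  Ψ-isCoalgebraMap = record { cop-hom = Ψ-cop ; ε-hom = Ψ-ε }

  -- ξ(1) = ξ(1 · 1) = 2 ξ(1), and H₀ is spanned by 1
  ξ-degree0≈0 : IsInfChar H ξ → ∀ i → ξ 0 i ≈ 0#
  ξ-degree0≈0 iξ i = x+x≈x⇒x≈0 (ξ 0 i) (≈-sym (begin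
    ξ 0 i                                                ≈⟨ ≈-sym (applyF-basis ξ 0 i) ⟩
    applyF ξ 0 (basis i)                                 ≈⟨ applyF-cong ξ 0 (λ j → ≈-sym (η-unit j)) ⟩
    applyF ξ 0 (λ j → η i *ᴷ μ 0 0 i i j)                ≈⟨ sumFin-cong (dim 0) (λ j → *-assoc _ _ _) ⟩
    sumFin (dim 0) (λ j → η i *ᴷ (μ 0 0 i i j *ᴷ ξ 0 j)) ≈⟨ ≈-sym (*-distribˡ-sumFin (dim 0) (η i) _) ⟩
    η i *ᴷ applyF ξ 0 (μ 0 0 i i)                        ≈⟨ *-congˡ (iξ 0 0 i i) ⟩
    η i *ᴷ (epsV (basis i) *ᴷ ξ 0 i +ᴷ ξ 0 i *ᴷ epsV (basis i))
      ≈⟨ *-congˡ (+-cong (*-congʳ (epsV-basis i)) (*-congˡ (epsV-basis i))) ⟩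
    η i *ᴷ (ε i *ᴷ ξ 0 i +ᴷ ξ 0 i *ᴷ ε i)                ≈⟨ distribˡ _ _ _ ⟩
    η i *ᴷ (ε i *ᴷ ξ 0 i) +ᴷ η i *ᴷ (ξ 0 i *ᴷ ε i)
      ≈⟨ +-cong (≈-trans (≈-sym (*-assoc _ _ _)) (≈-trans (*-congʳ ηε≈1) (*-identityˡ _)))
                (≈-trans (*-leftSwap _ _ _) (≈-trans (*-congˡ ηε≈1) (*-identityʳ _))) ⟩
    ξ 0 i +ᴷ ξ 0 i                                       ∎))
    where
    sum-degree0 : ∀ (f : Fin (dim 0) → Carrier) → sumFin (dim 0) f ≈ f i
    sum-degree0 f = sumFin-select (dim 0) i f (λ j i≢j → ⊥-elim (i≢j (Fin1-unique connected i j)))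
      where
      Fin1-unique : ∀ {n} → n ≡ 1 → (i j : Fin n) → i ≡ j
      Fin1-unique refl zero zero = refl
    ηε≈1 : η i *ᴷ ε i ≈ 1#
    ηε≈1 = ≈-trans (≈-sym (sum-degree0 (λ a → η a *ᴷ ε a))) ε-unit
    η-unit : ∀ j → η i *ᴷ μ 0 0 i i j ≈ basis i j
    η-unit j = ≈-trans (≈-sym (≈-trans (sum-degree0 _) (≈-trans (sum-degree0 _)
                 (*-congʳ (≈-trans (*-congˡ (basis-diag i)) (*-identityʳ _))))))
               (unitˡ 0 (basis i) j)

  Ψ-ξ : IsInfChar H ξ → _≈F_∘_ H Sh ξ ξS Ψ
  Ψ-ξ iξ zero    i = ≈-trans (ξ-degree0≈0 iξ i) (≈-sym (≈-trans (+-identityʳ _) (zeroʳ _)))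
  Ψ-ξ iξ (suc n) i = ≈-sym (begin
    Sh.applyF ξS (suc n) (Ψ (suc n) i)
      ≈⟨ ξS-applyF n (Ψ (suc n) i) ⟩
    ξΔ (compAt (suc n) (singletonIndex n)) (suc n) (basis i)
      ≈⟨ ≡⇒≈ (cong (λ γ → ξΔ γ (suc n) (basis i)) (proj₂ (indexOf (⊨-singleton n)))) ⟩
    applyF ξ (suc n) (cast (suc n) (suc n) (basis i))
      ≈⟨ ≈-trans (applyF-cong ξ (suc n) (cast-refl (suc n) (basis i))) (applyF-basis ξ (suc n) i) ⟩
    ξ (suc n) i ∎)

  singleton-coefficient : ∀ {Φ : GradedMap H Sh} → _≈F_∘_ H Sh ξ ξS Φ → ∀ n i → Φ (suc n) i (singletonIndex n) ≈ ξ (suc n) i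
  singleton-coefficient {Φ} Φ-ξ n i = ≈-sym (≈-trans (Φ-ξ (suc n) i) (ξS-applyF n (Φ (suc n) i)))

  module _ {Φ Φ′ : GradedMap H Sh} (Φ-coalg : IsCoalgebraMap H Sh Φ) (Φ-ξ : _≈F_∘_ H Sh ξ ξS Φ)
           (Φ′-coalg : IsCoalgebraMap H Sh Φ′) (Φ′-ξ : _≈F_∘_ H Sh ξ ξS Φ′) where
    private
      module Φ  = IsCoalgebraMap Φ-coalg
      module Φ′ = IsCoalgebraMap Φ′-coalg

      agree-on : ∀ {n γ} → γ ⊨ n → ∀ i k → compAt n k ≡ γ → Φ′ n i k ≈ Φ n i k
      agree-on [] i zero _ = begin
        Φ′ 0 i zero           ≈⟨ ≈-sym (≈-trans (+-identityʳ _) (*-identityʳ _)) ⟩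
        Sh.epsV (Φ′ 0 i)      ≈⟨ ≈-trans (Φ′.ε-hom i) (≈-sym (Φ.ε-hom i)) ⟩
        Sh.epsV (Φ 0 i)       ≈⟨ ≈-trans (+-identityʳ _) (*-identityʳ _) ⟩
        Φ 0 i zero            ∎
      agree-on (_∷_ a {γ′} {m} γ′⊨m) i k k↦γ = begin
        Φ′ (c₁ + m) i k         ≡⟨ cong (Φ′ (c₁ + m) i) k≡uv ⟩
        Φ′ (c₁ + m) i uv        ≈⟨ ≈-sym (Sh-cop c₁ m (Φ′ (c₁ + m) i) u v) ⟩
        Sh.cop c₁ m (Φ′ (c₁ + m) i) u v
          ≈⟨ Φ′.cop-hom c₁ m i u v ⟩
        sumFin (dim c₁) (λ x → sumFin (dim m) (λ y → δ c₁ m i x y *ᴷ Φ′ c₁ x u *ᴷ Φ′ m y v))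
          ≈⟨ sumFin-cong (dim c₁) (λ x → sumFin-cong (dim m) (λ y →
               *-cong (*-congˡ (≈-trans (singleton-coefficient Φ′-ξ a x) (≈-sym (singleton-coefficient Φ-ξ a x))))
                      (agree-on γ′⊨m y v v↦γ′))) ⟩
        sumFin (dim c₁) (λ x → sumFin (dim m) (λ y → δ c₁ m i x y *ᴷ Φ c₁ x u *ᴷ Φ m y v))
          ≈⟨ ≈-sym (Φ.cop-hom c₁ m i u v) ⟩
        Sh.cop c₁ m (Φ (c₁ + m) i) u v
          ≈⟨ Sh-cop c₁ m (Φ (c₁ + m) i) u v ⟩
        Φ (c₁ + m) i uv         ≡⟨ cong (Φ (c₁ + m) i) (sym k≡uv) ⟩
        Φ (c₁ + m) i k          ∎
        where
        c₁ = suc a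
        u = singletonIndex a
        v = proj₁ (indexOf γ′⊨m)
        v↦γ′ = proj₂ (indexOf γ′⊨m)
        uv = concatIndex c₁ m u v
        k≡uv : k ≡ uv
        k≡uv = index-unique (a ∷ γ′⊨m) k uv k↦γ
          (trans (proj₂ (indexOf (⊨-++ (compAt-⊨ F c₁ u) (compAt-⊨ F m v))))
                 (cong₂ _++_ (proj₂ (indexOf (⊨-singleton a))) v↦γ′))

    coalgebraMaps-agree : _≈map_ H Sh Φ′ Φ
    coalgebraMaps-agree n i k = agree-on (compAt-⊨ F n k) i k refl

-- Ψ is an algebra map

module AlgebraMap {c ℓ : Level} (F : Field c ℓ) (H : Over.GradedData F) (hH : Over.IsConnectedHopf F H)
                  (ξ : Over.Ops.Functional F H) (iξ : Over.IsInfChar F H ξ) where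
  open Over F
  open FiniteSums F
  open GradedData H
  open Ops H
  open GradedLinear F H
  open IsConnectedHopf hH
  open Coefficients F H hH ξ
  open CompositionSums F
  open MultipleSums F
  open CoalgebraMap F H hH ξ using (ξ-degree0≈0)

  shuffleSum : List ℕ → ∀ p q → V p → V q → Carrier
  shuffleSum γ p q a b =
    sumList (comps p) (λ α → sumList (comps q) (λ β → ξΔ α p a *ᴷ ξΔ β q b *ᴷ shuffleCoeff γ α β))

  -- the terms of shuffleSum (c ∷ γ′) in which the leading part c is taken from α, resp. from β
  leftHeadSum rightHeadSum : ℕ → List ℕ → ∀ p q → V p → V q → Carrier
  leftHeadSum c γ′ p q a b = sumList (comps q) (λ β → ξΔ β q b *ᴷ
    sumList (comps p) (λ α → onHead 0# c α (λ α′ → ξΔ (c ∷ α′) p a *ᴷ shuffleCoeff γ′ α′ β)))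
  rightHeadSum c γ′ p q a b = sumList (comps p) (λ α → ξΔ α p a *ᴷ
    sumList (comps q) (λ β → onHead 0# c β (λ β′ → ξΔ (c ∷ β′) q b *ᴷ shuffleCoeff γ′ α β′)))

  shuffleSum-∷ : ∀ c γ′ p q a b → shuffleSum (c ∷ γ′) p q a b ≈ leftHeadSum c γ′ p q a b +ᴷ rightHeadSum c γ′ p q a b
  shuffleSum-∷ c γ′ p q a b = begin
    shuffleSum (c ∷ γ′) p q a b
      ≈⟨ sumList-cong (comps p) (λ α → sumList-cong (comps q) (λ β → split α β)) ⟩
    sumList (comps p) (λ α → sumList (comps q) (λ β → t₁ α β +ᴷ t₂ α β))
      ≈⟨ ≈-trans (sumList-cong (comps p) (λ α → sumList-distrib-+ (comps q) _ _)) (sumList-distrib-+ (comps p) _ _) ⟩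
    sumList (comps p) (λ α → sumList (comps q) (t₁ α)) +ᴷ sumList (comps p) (λ α → sumList (comps q) (t₂ α))
      ≈⟨ +-cong (≈-trans (sumList-comm (comps p) (comps q) _)
                         (sumList-cong (comps q) (λ β → ≈-sym (*-distribˡ-sumList (comps p) _ _))))
                (sumList-cong (comps p) (λ α → ≈-sym (*-distribˡ-sumList (comps q) _ _))) ⟩
    leftHeadSum c γ′ p q a b +ᴷ rightHeadSum c γ′ p q a b ∎
    where
    t₁ t₂ : List ℕ → List ℕ → Carrier
    t₁ α β = ξΔ β q b *ᴷ onHead 0# c α (λ α′ → ξΔ (c ∷ α′) p a *ᴷ shuffleCoeff γ′ α′ β)
    t₂ α β = ξΔ α p a *ᴷ onHead 0# c β (λ β′ → ξΔ (c ∷ β′) q b *ᴷ shuffleCoeff γ′ α β′)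
    split : ∀ α β → ξΔ α p a *ᴷ ξΔ β q b *ᴷ shuffleCoeff (c ∷ γ′) α β ≈ t₁ α β +ᴷ t₂ α β
    split α β = begin
      ξΔ α p a *ᴷ ξΔ β q b *ᴷ shuffleCoeff (c ∷ γ′) α β
        ≈⟨ ≈-trans (*-congˡ (shuffleCoeff-∷ c γ′ α β)) (distribˡ _ _ _) ⟩
      ξΔ α p a *ᴷ ξΔ β q b *ᴷ onHead 0# c α (λ α′ → shuffleCoeff γ′ α′ β)
        +ᴷ ξΔ α p a *ᴷ ξΔ β q b *ᴷ onHead 0# c β (λ β′ → shuffleCoeff γ′ α β′)
        ≈⟨ +-cong (≈-trans (*-congʳ (*-comm _ _)) (≈-trans (*-assoc _ _ _) (*-congˡ (*-onHead c α (λ α′ → ξΔ α′ p a) _))))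
                  (≈-trans (*-assoc _ _ _) (*-congˡ (*-onHead c β (λ β′ → ξΔ β′ q b) _))) ⟩
      t₁ α β +ᴷ t₂ α β ∎

  leftHeadSum-offset : ∀ c₀ γ′ p′ q a b → leftHeadSum (suc c₀) γ′ (suc c₀ + p′) q a b
    ≈ sumList (comps q) (λ β → ξΔ β q b *ᴷ sumList (comps p′) (λ α′ → ξΔ (suc c₀ ∷ α′) (suc c₀ + p′) a *ᴷ shuffleCoeff γ′ α′ β))
  leftHeadSum-offset c₀ γ′ p′ q a b = sumList-cong (comps q) (λ β → *-congˡ (sumList-onHead-comps c₀ p′ _))

  leftHeadSum-< : ∀ c₀ γ′ p q a b → p < suc c₀ → leftHeadSum (suc c₀) γ′ p q a b ≈ 0#
  leftHeadSum-< c₀ γ′ p q a b p<c =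
    sumList-zero (comps q) (λ β → ≈-trans (*-congˡ (sumList-onHead-comps-< c₀ p _ p<c)) (zeroʳ _))

  rightHeadSum-offset : ∀ c₀ γ′ p m′ a b → rightHeadSum (suc c₀) γ′ p (suc c₀ + m′) a b
    ≈ sumList (comps p) (λ α → ξΔ α p a *ᴷ sumList (comps m′) (λ β′ → ξΔ (suc c₀ ∷ β′) (suc c₀ + m′) b *ᴷ shuffleCoeff γ′ α β′))
  rightHeadSum-offset c₀ γ′ p m′ a b = sumList-cong (comps p) (λ α → *-congˡ (sumList-onHead-comps c₀ m′ _))

  rightHeadSum-< : ∀ c₀ γ′ p q a b → q < suc c₀ → rightHeadSum (suc c₀) γ′ p q a b ≈ 0#
  rightHeadSum-< c₀ γ′ p q a b q<c =
    sumList-zero (comps p) (λ α → ≈-trans (*-congˡ (sumList-onHead-comps-< c₀ q _ q<c)) (zeroʳ _))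

  ξΔ-mulˡ : ∀ γ p q (a : V p) j → sumFin (dim p) (λ i → a i *ᴷ ξΔ γ (p + q) (μ p q i j)) ≈ ξΔ γ (p + q) (mul a (basis j))
  ξΔ-mulˡ γ p q a j = begin
    sumFin (dim p) (λ i → a i *ᴷ ξΔ γ (p + q) (μ p q i j))
      ≈⟨ sumFin-cong (dim p) (λ i → *-congˡ (ξΔ-linear γ (p + q) _)) ⟩
    sumFin (dim p) (λ i → a i *ᴷ sumFin (dim (p + q)) (λ k → μ p q i j k *ᴷ ξΔ γ (p + q) (basis k)))
      ≈⟨ ≈-sym (sumFin-matrix-assoc (dim p) (dim (p + q)) a (λ i k → μ p q i j k) _) ⟩
    sumFin (dim (p + q)) (λ k → sumFin (dim p) (λ i → a i *ᴷ μ p q i j k) *ᴷ ξΔ γ (p + q) (basis k))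
      ≈⟨ sumFin-cong (dim (p + q)) (λ k → *-congʳ (≈-sym (mul-basisʳ a j k))) ⟩
    sumFin (dim (p + q)) (λ k → mul a (basis j) k *ᴷ ξΔ γ (p + q) (basis k))
      ≈⟨ ≈-sym (ξΔ-linear γ (p + q) _) ⟩
    ξΔ γ (p + q) (mul a (basis j)) ∎

  ξΔ-mulʳ : ∀ γ p q (b : V q) i → sumFin (dim q) (λ j → b j *ᴷ ξΔ γ (p + q) (μ p q i j)) ≈ ξΔ γ (p + q) (mul (basis i) b)
  ξΔ-mulʳ γ p q b i = begin
    sumFin (dim q) (λ j → b j *ᴷ ξΔ γ (p + q) (μ p q i j))
      ≈⟨ sumFin-cong (dim q) (λ j → *-congˡ (ξΔ-linear γ (p + q) _)) ⟩
    sumFin (dim q) (λ j → b j *ᴷ sumFin (dim (p + q)) (λ k → μ p q i j k *ᴷ ξΔ γ (p + q) (basis k)))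
      ≈⟨ ≈-sym (sumFin-matrix-assoc (dim q) (dim (p + q)) b (λ j k → μ p q i j k) _) ⟩
    sumFin (dim (p + q)) (λ k → sumFin (dim q) (λ j → b j *ᴷ μ p q i j k) *ᴷ ξΔ γ (p + q) (basis k))
      ≈⟨ sumFin-cong (dim (p + q)) (λ k → *-congʳ (≈-sym (mul-basisˡ i b k))) ⟩
    sumFin (dim (p + q)) (λ k → mul (basis i) b k *ᴷ ξΔ γ (p + q) (basis k))
      ≈⟨ ≈-sym (ξΔ-linear γ (p + q) _) ⟩
    ξΔ γ (p + q) (mul (basis i) b) ∎

  ξΔ-∷-expand : ∀ c n β (b : V (c + n)) →
    sumFin (dim c) (λ u → sumFin (dim n) (λ v → (cop c n (cast (c + n) (c + n) b) u v *ᴷ ξ c u) *ᴷ ξΔ β n (basis v)))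
    ≈ ξΔ (c ∷ β) (c + n) b
  ξΔ-∷-expand c n β b = begin
    sumFin (dim c) (λ u → sumFin (dim n) (λ v → (Y u v *ᴷ ξ c u) *ᴷ ξΔ β n (basis v)))
      ≈⟨ sumFin-cong (dim c) (λ u → ≈-trans (sumFin-cong (dim n) (λ v → ≈-trans (*-assoc _ _ _) (*-leftSwap _ _ _)))
                                            (≈-sym (*-distribˡ-sumFin (dim n) _ _))) ⟩
    sumFin (dim c) (λ u → ξ c u *ᴷ sumFin (dim n) (λ v → Y u v *ᴷ ξΔ β n (basis v)))
      ≈⟨ sumFin-cong (dim c) (λ u → *-congˡ (≈-sym (ξΔ-linear β n (Y u)))) ⟩
    sumFin (dim c) (λ u → ξ c u *ᴷ ξΔ β n (Y u))
      ≈⟨ ≈-sym (ξΔ-∷ c β n (cast (c + n) (c + n) b)) ⟩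
    ξΔ (c ∷ β) (c + n) (cast (c + n) (c + n) b)
      ≈⟨ ξΔ-cong (c ∷ β) (c + n) (cast-refl (c + n) b) ⟩
    ξΔ (c ∷ β) (c + n) b ∎
    where
    Y : Fin (dim c) → Fin (dim n) → Carrier
    Y = cop c n (cast (c + n) (c + n) b)

  module Pairing (γ′ : List ℕ) where
    pairing : ∀ A B → T A B → Carrier
    pairing A B W = sumFin (dim A) (λ x → sumFin (dim B) (λ y → W x y *ᴷ (ξ A x *ᴷ ξΔ γ′ B (basis y))))

    pairing-cong : ∀ A B {W W′ : T A B} → (∀ x y → W x y ≈ W′ x y) → pairing A B W ≈ pairing A B W′
    pairing-cong A B W≈W′ = sumFin-cong (dim A) (λ x → sumFin-cong (dim B) (λ y → *-congʳ (W≈W′ x y)))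

    ξ⊗ξΔ≈pairing : ∀ A B (W : T A B) → sumFin (dim A) (λ x → ξ A x *ᴷ ξΔ γ′ B (W x)) ≈ pairing A B W
    ξ⊗ξΔ≈pairing A B W = sumFin-cong (dim A) (λ x → ≈-trans (*-congˡ (ξΔ-linear γ′ B (W x)))
      (≈-trans (*-distribˡ-sumFin (dim B) _ _) (sumFin-cong (dim B) (λ y → *-leftSwap _ _ _))))

    pairing-sumℕ : ∀ A B n (W : ℕ → T A B) → pairing A B (λ x y → sumℕ n (λ k → W k x y)) ≈ sumℕ n (λ k → pairing A B (W k))
    pairing-sumℕ A B n W = begin
      sumFin (dim A) (λ x → sumFin (dim B) (λ y → sumℕ n (λ k → W k x y) *ᴷ w x y))
        ≈⟨ sumFin-cong (dim A) (λ x → sumFin-cong (dim B) (λ y → *-distribʳ-sumℕ n (w x y) _)) ⟩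
      sumFin (dim A) (λ x → sumFin (dim B) (λ y → sumℕ n (λ k → W k x y *ᴷ w x y)))
        ≈⟨ sumFin-cong (dim A) (λ x → ≈-sym (sumℕ-sumFin-comm n (dim B) _)) ⟩
      sumFin (dim A) (λ x → sumℕ n (λ k → sumFin (dim B) (λ y → W k x y *ᴷ w x y)))
        ≈⟨ ≈-sym (sumℕ-sumFin-comm n (dim A) _) ⟩
      sumℕ n (λ k → pairing A B (W k)) ∎
      where
      w : Fin (dim A) → Fin (dim B) → Carrier
      w x y = ξ A x *ᴷ ξΔ γ′ B (basis y)

    pairing-castT : ∀ A B A′ B′ (W : T A B) → A ≡ A′ → B ≡ B′ → pairing A′ B′ (castT A B A′ B′ W) ≈ pairing A B W
    pairing-castT A B .A .B W refl refl = pairing-cong A B (castT-refl A B W)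

    pairing-mulT : ∀ A A′ B B′ (X : T A B) (Y : T A′ B′) → pairing (A + A′) (B + B′) (mulT X Y) ≈
      sumFin (dim A) (λ u → sumFin (dim B) (λ v → sumFin (dim A′) (λ u′ → sumFin (dim B′) (λ v′ →
        X u v *ᴷ Y u′ v′ *ᴷ (applyF ξ (A + A′) (μ A A′ u u′) *ᴷ ξΔ γ′ (B + B′) (μ B B′ v v′))))))
    pairing-mulT A A′ B B′ X Y = ≈-trans
      (sumFin-cong (dim (A + A′)) (λ x → sumFin-cong (dim (B + B′)) (λ y →
        *-distribʳ-sumFin⁴ (dim A) (dim B) (dim A′) (dim B′) _ _)))
      (≈-trans (sumFin²-sumFin⁴-comm (dim (A + A′)) (dim (B + B′)) (dim A) (dim B) (dim A′) (dim B′) _)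
               (sumFin⁴-cong (dim A) (dim B) (dim A′) (dim B′) collect))
      where
      collect : ∀ u v u′ v′ →
        sumFin (dim (A + A′)) (λ x → sumFin (dim (B + B′)) (λ y →
          X u v *ᴷ Y u′ v′ *ᴷ μ A A′ u u′ x *ᴷ μ B B′ v v′ y *ᴷ (ξ (A + A′) x *ᴷ ξΔ γ′ (B + B′) (basis y))))
        ≈ X u v *ᴷ Y u′ v′ *ᴷ (applyF ξ (A + A′) (μ A A′ u u′) *ᴷ ξΔ γ′ (B + B′) (μ B B′ v v′))
      collect u v u′ v′ = ≈-trans
        (sumFin²-factor (dim (A + A′)) (dim (B + B′)) (X u v *ᴷ Y u′ v′) (μ A A′ u u′) (ξ (A + A′)) (μ B B′ v v′)
                        (λ y → ξΔ γ′ (B + B′) (basis y)))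
        (*-congˡ (*-congˡ (≈-sym (ξΔ-linear γ′ (B + B′) (μ B B′ v v′)))))

  -- the summand of Δ_{(c,m)}(ab) = Σ Δ_{(A,B)}(a) Δ_{(A′,B′)}(b), paired with ξ ⊗ ξΔ γ′
  module CrossTerms (γ′ : List ℕ) (c m : ℕ) where
    open Pairing γ′

    crossTerm : ∀ {p q} (a : V p) (b : V q) A A′ B B′ → Carrier
    crossTerm {p} {q} a b A A′ B B′ =
      pairing c m (castT (A + A′) (B + B′) c m (mulT (cop A B (cast p (A + B) a)) (cop A′ B′ (cast q (A′ + B′) b))))

    crossTerm-expand : ∀ {p q} (a : V p) (b : V q) A A′ B B′ → A + A′ ≡ c → B + B′ ≡ m →
      crossTerm a b A A′ B B′ ≈ sumFin (dim A) (λ u → sumFin (dim B) (λ v → sumFin (dim A′) (λ u′ → sumFin (dim B′) (λ v′ →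
        cop A B (cast p (A + B) a) u v *ᴷ cop A′ B′ (cast q (A′ + B′) b) u′ v′ *ᴷ
        ((epsN A (basis u) *ᴷ ξ A′ u′ +ᴷ ξ A u *ᴷ epsN A′ (basis u′)) *ᴷ ξΔ γ′ (B + B′) (μ B B′ v v′))))))
    crossTerm-expand {p} {q} a b A A′ B B′ A+A′≡c B+B′≡m = ≈-trans (pairing-castT (A + A′) (B + B′) c m _ A+A′≡c B+B′≡m)
      (≈-trans (pairing-mulT A A′ B B′ _ _)
               (sumFin⁴-cong (dim A) (dim B) (dim A′) (dim B′) (λ u v u′ v′ → *-congˡ (*-congʳ (iξ A A′ u u′)))))

    crossTerm-mixed≈0 : ∀ {p q} (a : V p) (b : V q) A A′ B B′ → A + A′ ≡ c → B + B′ ≡ m → A ≢ 0 → A′ ≢ 0 →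
                        crossTerm a b A A′ B B′ ≈ 0#
    crossTerm-mixed≈0 a b A A′ B B′ A+A′≡c B+B′≡m A≢0 A′≢0 = ≈-trans (crossTerm-expand a b A A′ B B′ A+A′≡c B+B′≡m)
      (sumFin⁴-zero (dim A) (dim B) (dim A′) (dim B′) (λ u v u′ v′ → ≈-trans (*-congˡ (≈-trans (*-congʳ (≈-trans
        (+-cong (≈-trans (*-congʳ (epsN-≢0 A _ A≢0)) (zeroˡ _)) (≈-trans (*-congˡ (epsN-≢0 A′ _ A′≢0)) (zeroʳ _)))
        (+-identityˡ 0#))) (zeroˡ _))) (zeroʳ _)))

    crossTerm-offDegree≈0 : ∀ {p q} (a : V p) (b : V q) A A′ B B′ → A + A′ ≡ c → B + B′ ≡ m → p ≢ A + B →
                            crossTerm a b A A′ B B′ ≈ 0#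
    crossTerm-offDegree≈0 {p} a b A A′ B B′ A+A′≡c B+B′≡m p≢A+B = ≈-trans (crossTerm-expand a b A A′ B B′ A+A′≡c B+B′≡m)
      (sumFin⁴-zero (dim A) (dim B) (dim A′) (dim B′) (λ u v u′ v′ → ≈-trans (*-congʳ (≈-trans
        (*-congʳ (cop-zero A B _ (cast-≢ p (A + B) a p≢A+B) u v)) (zeroˡ _))) (zeroˡ _)))

    crossTerm-rightEnd : ∀ p m′ (a : V p) (b : V (c + m′)) → p + m′ ≡ m →
      (∀ (a′ : V p) (b′ : V m′) → ξΔ γ′ (p + m′) (mul a′ b′) ≈ shuffleSum γ′ p m′ a′ b′) →
      crossTerm a b 0 c p m′
      ≈ sumList (comps p) (λ α → ξΔ α p a *ᴷ sumList (comps m′) (λ β′ → ξΔ (c ∷ β′) (c + m′) b *ᴷ shuffleCoeff γ′ α β′))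
    crossTerm-rightEnd p m′ a b p+m′≡m ih = begin
      crossTerm a b 0 c p m′
        ≈⟨ crossTerm-expand a b 0 c p m′ refl p+m′≡m ⟩
      sumFin (dim 0) (λ u → sumFin (dim p) (λ v → sumFin (dim c) (λ u′ → sumFin (dim m′) (λ v′ →
        X u v *ᴷ Y u′ v′ *ᴷ ((epsN 0 (basis u) *ᴷ ξ c u′ +ᴷ ξ 0 u *ᴷ epsN c (basis u′)) *ᴷ R v v′)))))
        ≈⟨ sumFin⁴-cong (dim 0) (dim p) (dim c) (dim m′) summand ⟩
      sumFin (dim 0) (λ u → sumFin (dim p) (λ v → sumFin (dim c) (λ u′ → sumFin (dim m′) (λ v′ →
        (X u v *ᴷ ε u) *ᴷ (Y u′ v′ *ᴷ ξ c u′ *ᴷ R v v′)))))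
        ≈⟨ sumFin⁴-factorˡ (dim 0) (dim p) (dim c) (dim m′) (λ u v → X u v *ᴷ ε u) (λ v u′ v′ → Y u′ v′ *ᴷ ξ c u′ *ᴷ R v v′) ⟩
      sumFin (dim p) (λ v → sumFin (dim 0) (λ u → X u v *ᴷ ε u) *ᴷ
        sumFin (dim c) (λ u′ → sumFin (dim m′) (λ v′ → Y u′ v′ *ᴷ ξ c u′ *ᴷ R v v′)))
        ≈⟨ sumFin-cong (dim p) (λ v → *-congʳ (≈-trans (counitˡ p (cast p p a) v) (cast-refl p a v))) ⟩
      sumFin (dim p) (λ v → a v *ᴷ sumFin (dim c) (λ u′ → sumFin (dim m′) (λ v′ → (Y u′ v′ *ᴷ ξ c u′) *ᴷ R v v′)))
        ≈⟨ sumFin-sumFin²-comm (dim p) (dim c) (dim m′) a (λ u′ v′ → Y u′ v′ *ᴷ ξ c u′) R ⟩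
      sumFin (dim c) (λ u′ → sumFin (dim m′) (λ v′ → (Y u′ v′ *ᴷ ξ c u′) *ᴷ sumFin (dim p) (λ v → a v *ᴷ R v v′)))
        ≈⟨ sumFin-cong (dim c) (λ u′ → sumFin-cong (dim m′) (λ v′ →
             *-congˡ (≈-trans (ξΔ-mulˡ γ′ p m′ a v′) (ih a (basis v′))))) ⟩
      sumFin (dim c) (λ u′ → sumFin (dim m′) (λ v′ → (Y u′ v′ *ᴷ ξ c u′) *ᴷ shuffleSum γ′ p m′ a (basis v′)))
        ≈⟨ sumFin²-sumList²-comm (dim c) (dim m′) (comps p) (comps m′) (λ u′ v′ → Y u′ v′ *ᴷ ξ c u′)
             (λ α → ξΔ α p a) (λ β v′ → ξΔ β m′ (basis v′)) (shuffleCoeff γ′) ⟩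
      sumList (comps p) (λ α → ξΔ α p a *ᴷ sumList (comps m′) (λ β′ →
        sumFin (dim c) (λ u′ → sumFin (dim m′) (λ v′ → (Y u′ v′ *ᴷ ξ c u′) *ᴷ ξΔ β′ m′ (basis v′))) *ᴷ shuffleCoeff γ′ α β′))
        ≈⟨ sumList-cong (comps p) (λ α → *-congˡ (sumList-cong (comps m′) (λ β′ → *-congʳ (ξΔ-∷-expand c m′ β′ b)))) ⟩
      sumList (comps p) (λ α → ξΔ α p a *ᴷ sumList (comps m′) (λ β′ → ξΔ (c ∷ β′) (c + m′) b *ᴷ shuffleCoeff γ′ α β′)) ∎
      where
      X : Fin (dim 0) → Fin (dim p) → Carrier
      X = cop 0 p (cast p p a)
      Y : Fin (dim c) → Fin (dim m′) → Carrier
      Y = cop c m′ (cast (c + m′) (c + m′) b)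
      R : Fin (dim p) → Fin (dim m′) → Carrier
      R v v′ = ξΔ γ′ (p + m′) (μ p m′ v v′)
      summand : ∀ u v u′ v′ → X u v *ᴷ Y u′ v′ *ᴷ ((epsN 0 (basis u) *ᴷ ξ c u′ +ᴷ ξ 0 u *ᴷ epsN c (basis u′)) *ᴷ R v v′)
                              ≈ (X u v *ᴷ ε u) *ᴷ (Y u′ v′ *ᴷ ξ c u′ *ᴷ R v v′)
      summand u v u′ v′ = ≈-trans
        (*-congˡ (*-congʳ (≈-trans (+-cong (*-congʳ (epsV-basis u)) (≈-trans (*-congʳ (ξ-degree0≈0 iξ u)) (zeroˡ _)))
                                   (+-identityʳ _))))
        (solve 5 (λ x y e z r → x :* y :* ((e :* z) :* r)
                                       := (x :* e) :* (y :* z :* r)) ≈-refl _ _ _ _ _)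

    crossTerm-leftEnd : ∀ p′ q (a : V (c + p′)) (b : V q) → p′ + q ≡ m →
      (∀ (a′ : V p′) (b′ : V q) → ξΔ γ′ (p′ + q) (mul a′ b′) ≈ shuffleSum γ′ p′ q a′ b′) →
      crossTerm a b c 0 p′ q
      ≈ sumList (comps q) (λ β → ξΔ β q b *ᴷ sumList (comps p′) (λ α′ → ξΔ (c ∷ α′) (c + p′) a *ᴷ shuffleCoeff γ′ α′ β))
    crossTerm-leftEnd p′ q a b p′+q≡m ih = begin
      crossTerm a b c 0 p′ q
        ≈⟨ crossTerm-expand a b c 0 p′ q (ℕ.+-identityʳ c) p′+q≡m ⟩
      sumFin (dim c) (λ u → sumFin (dim p′) (λ v → sumFin (dim 0) (λ u′ → sumFin (dim q) (λ v′ →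
        X u v *ᴷ Y u′ v′ *ᴷ ((epsN c (basis u) *ᴷ ξ 0 u′ +ᴷ ξ c u *ᴷ epsN 0 (basis u′)) *ᴷ R v v′)))))
        ≈⟨ sumFin⁴-cong (dim c) (dim p′) (dim 0) (dim q) summand ⟩
      sumFin (dim c) (λ u → sumFin (dim p′) (λ v → sumFin (dim 0) (λ u′ → sumFin (dim q) (λ v′ →
        (Y u′ v′ *ᴷ ε u′) *ᴷ (X u v *ᴷ ξ c u *ᴷ R v v′)))))
        ≈⟨ sumFin⁴-factorʳ (dim c) (dim p′) (dim 0) (dim q) (λ u′ v′ → Y u′ v′ *ᴷ ε u′) (λ u v v′ → X u v *ᴷ ξ c u *ᴷ R v v′) ⟩
      sumFin (dim q) (λ v′ → sumFin (dim 0) (λ u′ → Y u′ v′ *ᴷ ε u′) *ᴷ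
        sumFin (dim c) (λ u → sumFin (dim p′) (λ v → X u v *ᴷ ξ c u *ᴷ R v v′)))
        ≈⟨ sumFin-cong (dim q) (λ v′ → *-congʳ (≈-trans (counitˡ q (cast q q b) v′) (cast-refl q b v′))) ⟩
      sumFin (dim q) (λ v′ → b v′ *ᴷ sumFin (dim c) (λ u → sumFin (dim p′) (λ v → (X u v *ᴷ ξ c u) *ᴷ R v v′)))
        ≈⟨ sumFin-sumFin²-comm (dim q) (dim c) (dim p′) b (λ u v → X u v *ᴷ ξ c u) (λ v′ v → R v v′) ⟩
      sumFin (dim c) (λ u → sumFin (dim p′) (λ v → (X u v *ᴷ ξ c u) *ᴷ sumFin (dim q) (λ v′ → b v′ *ᴷ R v v′)))
        ≈⟨ sumFin-cong (dim c) (λ u → sumFin-cong (dim p′) (λ v →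
             *-congˡ (≈-trans (ξΔ-mulʳ γ′ p′ q b v) (ih (basis v) b)))) ⟩
      sumFin (dim c) (λ u → sumFin (dim p′) (λ v → (X u v *ᴷ ξ c u) *ᴷ shuffleSum γ′ p′ q (basis v) b))
        ≈⟨ sumFin²-sumList²-comm′ (dim c) (dim p′) (comps p′) (comps q) (λ u v → X u v *ᴷ ξ c u)
             (λ β → ξΔ β q b) (λ α v → ξΔ α p′ (basis v)) (shuffleCoeff γ′) ⟩
      sumList (comps q) (λ β → ξΔ β q b *ᴷ sumList (comps p′) (λ α′ →
        sumFin (dim c) (λ u → sumFin (dim p′) (λ v → (X u v *ᴷ ξ c u) *ᴷ ξΔ α′ p′ (basis v))) *ᴷ shuffleCoeff γ′ α′ β))
        ≈⟨ sumList-cong (comps q) (λ β → *-congˡ (sumList-cong (comps p′) (λ α′ → *-congʳ (ξΔ-∷-expand c p′ α′ a)))) ⟩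
      sumList (comps q) (λ β → ξΔ β q b *ᴷ sumList (comps p′) (λ α′ → ξΔ (c ∷ α′) (c + p′) a *ᴷ shuffleCoeff γ′ α′ β)) ∎
      where
      X : Fin (dim c) → Fin (dim p′) → Carrier
      X = cop c p′ (cast (c + p′) (c + p′) a)
      Y : Fin (dim 0) → Fin (dim q) → Carrier
      Y = cop 0 q (cast q q b)
      R : Fin (dim p′) → Fin (dim q) → Carrier
      R v v′ = ξΔ γ′ (p′ + q) (μ p′ q v v′)
      summand : ∀ u v u′ v′ → X u v *ᴷ Y u′ v′ *ᴷ ((epsN c (basis u) *ᴷ ξ 0 u′ +ᴷ ξ c u *ᴷ epsN 0 (basis u′)) *ᴷ R v v′)
                              ≈ (Y u′ v′ *ᴷ ε u′) *ᴷ (X u v *ᴷ ξ c u *ᴷ R v v′)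
      summand u v u′ v′ = ≈-trans
        (*-congˡ (*-congʳ (≈-trans (+-cong (≈-trans (*-congˡ (ξ-degree0≈0 iξ u′)) (zeroʳ _)) (*-congˡ (epsV-basis u′)))
                                   (+-identityˡ _))))
        (solve 5 (λ x y e z r → x :* y :* ((z :* e) :* r)
                                       := (y :* e) :* (x :* z :* r)) ≈-refl _ _ _ _ _)

  data Offset (c q : ℕ) : Set where
    offset : ∀ m′ → q ≡ c + m′ → Offset c q
    below  : q < c → Offset c q

  offset? : ∀ c q → Offset c q
  offset? c q with c ≤? q
  ... | yes c≤q = offset (q ∸ c) (sym (ℕ.m+[n∸m]≡n c≤q))
  ... | no  c≰q = below (ℕ.≰⇒> c≰q)

  module HeadStep (γ′ : List ℕ) (c₀ m : ℕ)
                  (ih : ∀ p′ q′ → p′ + q′ ≡ m → (a′ : V p′) (b′ : V q′) →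
                        ξΔ γ′ (p′ + q′) (mul a′ b′) ≈ shuffleSum γ′ p′ q′ a′ b′)
                  where
    c₁ = suc c₀
    open Pairing γ′
    open CrossTerms γ′ c₁ m

    private
      m∸n≡o : ∀ {n o} → n + o ≡ m → m ∸ n ≡ o
      m∸n≡o {n} {o} n+o≡m = trans (cong (_∸ n) (sym n+o≡m)) (ℕ.m+n∸m≡n n o)

      <1+m : ∀ {n o} → n + o ≡ m → n < suc m
      <1+m {n} {o} n+o≡m = s≤s (subst (n ≤_) n+o≡m (ℕ.m≤m+n n o))

      split-m : ∀ {q₁} → q₁ < suc m → q₁ + (m ∸ q₁) ≡ m
      split-m q₁<1+m = ℕ.m+[n∸m]≡n (ℕ.≤-pred q₁<1+m)

    crossTerms : ∀ {p q} → V p → V q → Carrier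
    crossTerms a b = sumℕ (suc c₁) (λ p₁ → sumℕ (suc m) (λ q₁ → crossTerm a b p₁ (c₁ ∸ p₁) q₁ (m ∸ q₁)))

    ξΔ-∷-mul : ∀ p q → p + q ≡ c₁ + m → (a : V p) (b : V q) → ξΔ (c₁ ∷ γ′) (p + q) (mul a b) ≈ crossTerms a b
    ξΔ-∷-mul p q p+q≡ a b = begin
      ξΔ (c₁ ∷ γ′) (p + q) (mul a b)
        ≈⟨ cast-invariant p+q≡ (ξΔ (c₁ ∷ γ′)) (ξΔ-cong (c₁ ∷ γ′)) (mul a b) ⟩
      ξΔ (c₁ ∷ γ′) (c₁ + m) (cast (p + q) (c₁ + m) (mul a b))
        ≈⟨ ξΔ-∷ c₁ γ′ m _ ⟩
      sumFin (dim c₁) (λ x → ξ c₁ x *ᴷ ξΔ γ′ m (cop c₁ m (cast (p + q) (c₁ + m) (mul a b)) x))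
        ≈⟨ ξ⊗ξΔ≈pairing c₁ m _ ⟩
      pairing c₁ m (cop c₁ m (cast (p + q) (c₁ + m) (mul a b)))
        ≈⟨ pairing-cong c₁ m (Δ-mul p q c₁ m a b) ⟩
      pairing c₁ m (λ x y → sumℕ (suc c₁) (λ p₁ → sumℕ (suc m) (λ q₁ → W p₁ q₁ x y)))
        ≈⟨ pairing-sumℕ c₁ m (suc c₁) (λ p₁ x y → sumℕ (suc m) (λ q₁ → W p₁ q₁ x y)) ⟩
      sumℕ (suc c₁) (λ p₁ → pairing c₁ m (λ x y → sumℕ (suc m) (λ q₁ → W p₁ q₁ x y)))
        ≈⟨ sumℕ-cong (suc c₁) (λ p₁ → pairing-sumℕ c₁ m (suc m) (W p₁)) ⟩
      crossTerms a b ∎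
      where
      W : ℕ → ℕ → T c₁ m
      W p₁ q₁ = castT (p₁ + (c₁ ∸ p₁)) (q₁ + (m ∸ q₁)) c₁ m
        (mulT (cop p₁ q₁ (cast p (p₁ + q₁) a)) (cop (c₁ ∸ p₁) (m ∸ q₁) (cast q ((c₁ ∸ p₁) + (m ∸ q₁)) b)))

    rightEnd leftEnd : ∀ {p q} → V p → V q → Carrier
    rightEnd a b = sumℕ (suc m) (λ q₁ → crossTerm a b 0 c₁ q₁ (m ∸ q₁))
    leftEnd  a b = sumℕ (suc m) (λ q₁ → crossTerm a b c₁ 0 q₁ (m ∸ q₁))

    crossTerms≈ends : ∀ {p q} (a : V p) (b : V q) → crossTerms a b ≈ rightEnd a b +ᴷ leftEnd a b
    crossTerms≈ends a b = +-congˡ (≈-trans (sumℕ-select (suc c₀) c₀ (ℕ.n<1+n c₀) mixed≈0)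
      (≡⇒≈ (cong (λ z → sumℕ (suc m) (λ q₁ → crossTerm a b c₁ z q₁ (m ∸ q₁))) (ℕ.n∸n≡0 c₀))))
      where
      mixed≈0 : ∀ k → k < suc c₀ → k ≢ c₀ → sumℕ (suc m) (λ q₁ → crossTerm a b (suc k) (c₀ ∸ k) q₁ (m ∸ q₁)) ≈ 0#
      mixed≈0 k (s≤s k≤c₀) k≢c₀ = sumℕ-zero-< (suc m) (λ q₁ q₁<1+m →
        crossTerm-mixed≈0 a b (suc k) (c₀ ∸ k) q₁ (m ∸ q₁) (cong suc (ℕ.m+[n∸m]≡n k≤c₀)) (split-m q₁<1+m) (λ ())
          (λ c₀∸k≡0 → k≢c₀ (ℕ.≤-antisym k≤c₀ (ℕ.m∸n≡0⇒m≤n c₀∸k≡0))))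

    rightEnd≈rightHeadSum : ∀ p q → p + q ≡ c₁ + m → (a : V p) (b : V q) → rightEnd a b ≈ rightHeadSum c₁ γ′ p q a b
    rightEnd≈rightHeadSum p q p+q≡ a b with offset? c₁ q
    ... | offset m′ refl = begin
      rightEnd a b
        ≈⟨ sumℕ-select (suc m) p (<1+m p+m′≡m) (λ q₁ q₁<1+m q₁≢p →
             crossTerm-offDegree≈0 a b 0 c₁ q₁ (m ∸ q₁) refl (split-m q₁<1+m) (λ p≡q₁ → q₁≢p (sym p≡q₁))) ⟩
      crossTerm a b 0 c₁ p (m ∸ p)
        ≡⟨ cong (crossTerm a b 0 c₁ p) (m∸n≡o p+m′≡m) ⟩
      crossTerm a b 0 c₁ p m′
        ≈⟨ crossTerm-rightEnd p m′ a b p+m′≡m (ih p m′ p+m′≡m) ⟩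
      sumList (comps p) (λ α → ξΔ α p a *ᴷ sumList (comps m′) (λ β′ → ξΔ (c₁ ∷ β′) (c₁ + m′) b *ᴷ shuffleCoeff γ′ α β′))
        ≈⟨ ≈-sym (rightHeadSum-offset c₀ γ′ p m′ a b) ⟩
      rightHeadSum c₁ γ′ p (c₁ + m′) a b ∎
      where
      p+m′≡m : p + m′ ≡ m
      p+m′≡m = ℕ.+-cancelˡ-≡ c₁ (p + m′) m (trans (ℕ.+-comm c₁ (p + m′))
                 (trans (ℕ.+-assoc p m′ c₁) (trans (cong (p +_) (ℕ.+-comm m′ c₁)) p+q≡)))
    ... | below q<c₁ = ≈-trans
      (sumℕ-zero-< (suc m) (λ q₁ q₁<1+m → crossTerm-offDegree≈0 a b 0 c₁ q₁ (m ∸ q₁) refl (split-m q₁<1+m) (p≢q₁ q₁<1+m)))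
      (≈-sym (rightHeadSum-< c₀ γ′ p q a b q<c₁))
      where
      p≢q₁ : ∀ {q₁} → q₁ < suc m → p ≢ q₁
      p≢q₁ (s≤s q₁≤m) refl = ℕ.<-irrefl (trans p+q≡ (ℕ.+-comm c₁ m)) (ℕ.+-mono-≤-< q₁≤m q<c₁)

    leftEnd≈leftHeadSum : ∀ p q → p + q ≡ c₁ + m → (a : V p) (b : V q) → leftEnd a b ≈ leftHeadSum c₁ γ′ p q a b
    leftEnd≈leftHeadSum p q p+q≡ a b with offset? c₁ p
    ... | offset p′ refl = begin
      leftEnd a b
        ≈⟨ sumℕ-select (suc m) p′ (<1+m p′+q≡m) (λ q₁ q₁<1+m q₁≢p′ →
             crossTerm-offDegree≈0 a b c₁ 0 q₁ (m ∸ q₁) (ℕ.+-identityʳ c₁) (split-m q₁<1+m)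
               (λ e → q₁≢p′ (sym (ℕ.+-cancelˡ-≡ c₁ p′ q₁ e)))) ⟩
      crossTerm a b c₁ 0 p′ (m ∸ p′)
        ≡⟨ cong (crossTerm a b c₁ 0 p′) (m∸n≡o p′+q≡m) ⟩
      crossTerm a b c₁ 0 p′ q
        ≈⟨ crossTerm-leftEnd p′ q a b p′+q≡m (ih p′ q p′+q≡m) ⟩
      sumList (comps q) (λ β → ξΔ β q b *ᴷ sumList (comps p′) (λ α′ → ξΔ (c₁ ∷ α′) (c₁ + p′) a *ᴷ shuffleCoeff γ′ α′ β))
        ≈⟨ ≈-sym (leftHeadSum-offset c₀ γ′ p′ q a b) ⟩
      leftHeadSum c₁ γ′ (c₁ + p′) q a b ∎
      where
      p′+q≡m : p′ + q ≡ m
      p′+q≡m = ℕ.+-cancelˡ-≡ c₁ (p′ + q) m (trans (sym (ℕ.+-assoc c₁ p′ q)) p+q≡)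
    ... | below p<c₁ = ≈-trans
      (sumℕ-zero-< (suc m) (λ q₁ q₁<1+m → crossTerm-offDegree≈0 a b c₁ 0 q₁ (m ∸ q₁) (ℕ.+-identityʳ c₁) (split-m q₁<1+m)
        (λ p≡c₁+q₁ → ℕ.<-irrefl refl (ℕ.<-≤-trans p<c₁ (subst (c₁ ≤_) (sym p≡c₁+q₁) (ℕ.m≤m+n c₁ q₁))))))
      (≈-sym (leftHeadSum-< c₀ γ′ p q a b p<c₁))

  ξΔ-mul : ∀ {N γ} → γ ⊨ N → ∀ p q → p + q ≡ N → (a : V p) (b : V q) → ξΔ γ (p + q) (mul a b) ≈ shuffleSum γ p q a b
  ξΔ-mul [] zero zero refl a b = ≈-trans (ε-mul a b)
    (≈-sym (≈-trans (+-identityʳ _) (≈-trans (+-identityʳ _) (≈-trans (*-congˡ (+-identityʳ 1#)) (*-identityʳ _)))))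
  ξΔ-mul (_∷_ c₀ {γ′} {m} γ′⊨m) p q p+q≡ a b = begin
    ξΔ (suc c₀ ∷ γ′) (p + q) (mul a b)                       ≈⟨ ξΔ-∷-mul p q p+q≡ a b ⟩
    crossTerms a b                                          ≈⟨ crossTerms≈ends a b ⟩
    rightEnd a b +ᴷ leftEnd a b                             ≈⟨ +-cong (rightEnd≈rightHeadSum p q p+q≡ a b)
                                                                      (leftEnd≈leftHeadSum p q p+q≡ a b) ⟩
    rightHeadSum c₁ γ′ p q a b +ᴷ leftHeadSum c₁ γ′ p q a b  ≈⟨ +-comm _ _ ⟩
    leftHeadSum c₁ γ′ p q a b +ᴷ rightHeadSum c₁ γ′ p q a b  ≈⟨ ≈-sym (shuffleSum-∷ c₁ γ′ p q a b) ⟩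
    shuffleSum (suc c₀ ∷ γ′) p q a b                        ∎
    where open HeadStep γ′ c₀ m (ξΔ-mul γ′⊨m)

  open CoalgebraMap F H hH ξ using (Ψ)
  open ShuffleAlgebra F using (module Sh)

  Ψ-mul : ∀ p q i j → Sh._≈v_ {p + q} (linMap H Sh Ψ (p + q) (μ p q i j)) (Sh.mul {p} {q} (Ψ p i) (Ψ q j))
  Ψ-mul p q i j w = begin
    sumFin (dim (p + q)) (λ k → μ p q i j k *ᴷ ξΔ γ (p + q) (basis k))
      ≈⟨ ≈-sym (ξΔ-linear γ (p + q) (μ p q i j)) ⟩
    ξΔ γ (p + q) (μ p q i j)
      ≈⟨ ξΔ-cong γ (p + q) (λ k → ≈-sym (≈-trans (mul-basisˡ i (basis j) k) (sumFin-basisˡ j (λ j′ → μ p q i j′ k)))) ⟩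
    ξΔ γ (p + q) (mul (basis i) (basis j))
      ≈⟨ ξΔ-mul (compAt-⊨ F (p + q) w) p q refl (basis i) (basis j) ⟩
    shuffleSum γ p q (basis i) (basis j)
      ≈⟨ ≈-sym (≈-trans (sumFin-cong (length (comps p)) (λ u → sumFin-lookup (comps q) (G (lookup (comps p) u))))
                        (sumFin-lookup (comps p) (λ α → sumList (comps q) (G α)))) ⟩
    Sh.mul {p} {q} (Ψ p i) (Ψ q j) w ∎
    where
    γ = compAt (p + q) w
    G : List ℕ → List ℕ → Carrier
    G α β = ξΔ α p (basis i) *ᴷ ξΔ β q (basis j) *ᴷ shuffleCoeff γ α β

  Ψ-isAlgebraMap : IsAlgebraMap H Sh Ψ
  Ψ-isAlgebraMap = record
    { mul-hom  = Ψ-mul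
    ; unit-hom = λ { zero → ≈-trans (sumFin-cong (dim 0) (λ i → *-congˡ (epsV-basis i))) ε-unit }
    }

theorem3p10 : ∀ {c ℓ : Level} (F : Field c ℓ) →
    let open Over F in
    (H : GradedData) → IsConnectedHopf H →
    (ξ : Ops.Functional H) → IsInfChar H ξ →
    Σ (GradedMap H Sh) λ Ψ →
      -- (i) Ψ is a graded coalgebra map with ξ = ξ_S ∘ Ψ, and the unique one
      (IsCoalgebraMap H Sh Ψ × _≈F_∘_ H Sh ξ ξS Ψ
        × (∀ (Ψ′ : GradedMap H Sh) → IsCoalgebraMap H Sh Ψ′ → _≈F_∘_ H Sh ξ ξS Ψ′ → _≈map_ H Sh Ψ′ Ψ))
      -- (ii) Ψ is an algebra map, hence a map of infinitorial Hopf algebras, and the unique one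
      × (IsAlgebraMap H Sh Ψ
        × (∀ (Φ : GradedMap H Sh) → IsHopfMap H Sh Φ → _≈F_∘_ H Sh ξ ξS Φ → _≈map_ H Sh Φ Ψ))
      -- (iii) for h = e_i ∈ H_n, the coefficient of x_α (α = compAt n k ⊨ n) in Ψ(h)
      --       is ξ^{⊗ ℓ(α)} Δ_α (h)
      × (∀ n i k →
          Field._≈_ F (Ψ n i k) (xiΔ H ξ (compAt n k) n (Ops.basis H i)))
theorem3p10 F H hH ξ iξ =
  Ψ , ( (Ψ-isCoalgebraMap , Ψ-ξ iξ , λ Ψ′ Ψ′-coalg Ψ′-ξ → coalgebraMaps-agree Ψ-isCoalgebraMap (Ψ-ξ iξ) Ψ′-coalg Ψ′-ξ)
      , (Ψ-isAlgebraMap , λ Φ Φ-hopf Φ-ξ → coalgebraMaps-agree Ψ-isCoalgebraMap (Ψ-ξ iξ) (proj₁ Φ-hopf) Φ-ξ)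
      , λ n i k → Field.refl F )
  where
  open CoalgebraMap F H hH ξ
  open AlgebraMap F H hH ξ iξ using (Ψ-isAlgebraMap)
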